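{- Let $d\ge 1$ be an integer, $q$ a prime power and $n\ge 1$. Choose $a_0(x),\ldots,a_{n-1}(x)\in\mathbb{F}_q[x]$ independently and uniformly at random from the polynomials of degree at most $d$, and let $f(x,y)=y^n+a_{n-1}(x)y^{n-1}+\cdots+a_0(x)\in\mathbb{F}_q[x][y]$. Write uniquely $f=c(y)g(x,y)$ with $c=\mathrm{con}_x(f)\in\mathbb{F}_q[y]$ and $g\in\mathbb{F}_q[x][y]$ monic in $y$ with $\mathrm{con}_x(g)=1$. Then for every $0\le k\le n-1$ and every monic $c_0\in\mathbb{F}_q[y]$ with $\deg c_0=k$, $$\mathbb{P}\bigl(\mathrm{con}_x(f)=c_0\text{ and }\deg_y g=n-k\bigr)=\left(1-\frac{1}{q^d}\right)\frac{1}{q^{k(d+1)}}.$$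
   Context: $\mathrm{con}_x(f)$ denotes the monic greatest common divisor of the coefficients of $f$ viewed as a polynomial in $x$ over $\mathbb{F}_q[y]$. -}

module Defs where

open import Level using (0ℓ)
open import Data.Nat using (ℕ; zero; suc; _∸_; _<_; _<?_; _⊔_) renaming (_+_ to _+ℕ_)
open import Data.Fin using (Fin) renaming (zero to fzero; suc to fsuc)
open import Data.Bool using (Bool; true; false; if_then_else_)
open import Data.List using (List; []; _∷_; length; last; foldr; map; _++_)
open import Data.Vec as Vec using (Vec)
open import Data.Maybe using (Maybe; just; nothing)
open import Data.Product using (_×_; _,_; proj₁; proj₂)
open import Relation.Nullary using (¬_; Dec; yes; no; does)
open import Relation.Binary.PropositionalEquality using (_≡_)
open import Relation.Binary.Definitions using (DecidableEquality)
open import Algebra.Structures using (IsCommutativeRing)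
open import Function.Bundles using (_↔_)

-- A finite field with q elements (F_q for a prime power q; every finite
-- field has prime-power order and for each prime power one exists).

record FiniteField : Set₁ where
  field
    F      : Set
    _≟_    : DecidableEquality F
    _+_ _*_ : F → F → F
    -_     : F → F
    0# 1#  : F
    isCommutativeRing : IsCommutativeRing _≡_ _+_ _*_ -_ 0# 1#
    _⁻¹    : F → F
    ⁻¹-inverse : ∀ x → ¬ (x ≡ 0#) → x * (x ⁻¹) ≡ 1#
    0≢1    : ¬ (0# ≡ 1#)
    q      : ℕ
    enum   : F ↔ Fin q

-- Univariate polynomials F[y] as coefficient lists, lowest degree first.
-- Canonical form: no trailing zero coefficient (the zero polynomial is []).

module Poly (𝔽 : FiniteField) where
  open FiniteField 𝔽 renaming (_+_ to _+F_; _*_ to _*F_; -_ to -F_)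

  P : Set
  P = List F

  norm : P → P
  norm [] = []
  norm (a ∷ p) with norm p
  ... | [] = if does (a ≟ 0#) then [] else (a ∷ [])
  ... | r@(_ ∷ _) = a ∷ r

  -- degree (convention: the zero polynomial gets degree 0; it is never
  -- used for the zero polynomial in the statement)
  deg : P → ℕ
  deg p = length (norm p) ∸ 1

  lead : P → F
  lead p with last (norm p)
  ... | just a = a
  ... | nothing = 0#

  Monic : P → Set
  Monic p = last p ≡ just 1#

  add' : P → P → P
  add' [] p = p
  add' p [] = p
  add' (a ∷ p) (b ∷ r) = (a +F b) ∷ add' p r

  _⊕_ : P → P → P
  p ⊕ r = norm (add' p r)

  scale : F → P → P
  scale c p = norm (map (c *F_) p)

  neg : P → P
  neg p = scale (-F 1#) p

  shift : ℕ → P → P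
  shift zero p = p
  shift (suc m) p = norm (0# ∷ shift m p)

  _⊗_ : P → P → P
  [] ⊗ r = []
  (a ∷ p) ⊗ r = scale a r ⊕ shift 1 (p ⊗ r)

  -- make monic (zero stays zero)
  monic : P → P
  monic p = scale (lead p ⁻¹) p

  -- long division by b ≠ 0 with a fuel bound (fuel = length p + 1 suffices,
  -- since each step strictly lowers the length of the remainder)
  divStep : ℕ → P → P → P × P → P × P
  divStep zero b r acc = acc
  divStep (suc fuel) b r (qu , _) with length (norm r) <? length (norm b)
  ... | yes _ = qu , norm r
  ... | no _ =
    let c = lead r *F (lead b ⁻¹)
        m = length (norm r) ∸ length (norm b)
        t = shift m (c ∷ [])
    in divStep fuel b (r ⊕ neg (t ⊗ b)) (qu ⊕ t , [])

  quotRem : P → P → P × P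
  quotRem p b = divStep (suc (length p)) b (norm p) ([] , norm p)

  quot : P → P → P
  quot p b = proj₁ (quotRem p b)

  rem : P → P → P
  rem p b = proj₂ (quotRem p b)

  -- Euclid's algorithm with fuel (the sum of the lengths strictly decreases)
  gcdF : ℕ → P → P → P
  gcdF zero a b = a
  gcdF (suc fuel) a b with norm b
  ... | [] = norm a
  ... | b'@(_ ∷ _) = gcdF fuel b' (rem a b')

  gcd : P → P → P
  gcd a b = monic (gcdF (suc (length a +ℕ length b)) a b)

  -- monic gcd of a list of polynomials (gcd of the empty list is 0)
  gcdList : List P → P
  gcdList = foldr gcd []

  -- The bivariate setting.  a : Vec (Vec F (suc d)) n encodes
  -- a_0(x),...,a_{n-1}(x) of degree ≤ d: (a[i])[j] is the coefficient of
  -- x^j in a_i(x).  f(x,y) = y^n + Σ_i a_i(x) y^i is stored, as a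
  -- polynomial in x over F[y], by its x-coefficients b_0(y),...,b_d(y):
  --   b_j(y) = Σ_i a_{i,j} y^i + [j = 0] y^n.

  xCoeffs : ∀ {d n} → Vec (Vec F (suc d)) n → List P
  xCoeffs {d} {n} a = Vec.toList (Vec.tabulate {n = suc d} b)
    where
      b : Fin (suc d) → P
      b j = norm (Vec.toList (Vec.map (λ ai → Vec.lookup ai j) a)
                   ++ ((if isZero j then 1# else 0#) ∷ []))
        where
          isZero : ∀ {m} → Fin (suc m) → Bool
          isZero fzero = true
          isZero (fsuc _) = false

  conX : ∀ {d n} → Vec (Vec F (suc d)) n → P
  conX a = gcdList (xCoeffs a)

  gXCoeffs : ∀ {d n} → Vec (Vec F (suc d)) n → List P
  gXCoeffs a = map (λ b → quot b (conX a)) (xCoeffs a)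

  degYg : ∀ {d n} → Vec (Vec F (suc d)) n → ℕ
  degYg a = foldr (λ c m → deg c ⊔ m) 0 (gXCoeffs a)

{-# OPTIONS --safe #-}
module Submission where

-- Write f through its x-coefficients b₀, …, b_d ∈ F_q[y]; such a tuple has height n when b₀ is
-- monic of degree n and the others have degree < n. Then con_x(f) is their monic gcd, and dividing
-- by a monic c of degree k is a bijection from the tuples of height n with content c onto the
-- primitive tuples (content 1) of height n − k. A tuple of height m + 1 whose content c ≠ 1 is
-- written c = g₀ + y H, H monic, corresponds to the pair of g₀ and a tuple of height m with
-- content H, so T(m+1) = N(m+1) + q T(m) for the numbers T(m) = q^((d+1)m) of all and N(m) of
-- primitive tuples of height m. Hence N(n − k) = (q^d − 1) q^((d+1)(n−k−1)+1), the claim.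

open import Defs

open import Data.Nat as ℕ using (ℕ; zero; suc; _+_; _*_; _^_; _∸_; _≤_; _<_; _≥_; z≤n; s≤s; _⊔_; _<?_)
import Data.Nat.Properties as ℕP
open import Data.Nat.Tactic.RingSolver using (solve-∀)
open import Data.Fin as Fin using (Fin) renaming (zero to fzero; suc to fsuc)
import Data.Fin.Properties as Finₚ
open import Data.Vec as Vec using (Vec)
import Data.Vec.Properties as Vecₚ
open import Data.List using (List; []; _∷_; length; last; foldr; map; _++_)
import Data.List.Properties as List
open import Data.List.Relation.Unary.All using (All; []; _∷_)
import Data.List.Relation.Unary.All as All
import Data.List.Relation.Unary.All.Properties as Allₚ
open import Data.Maybe using (just)
import Data.Maybe.Properties as Maybe
open import Data.Product using (Σ; ∃; ∃₂; _×_; _,_; proj₁; proj₂)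
open import Data.Sum using (_⊎_; inj₁; inj₂)
open import Data.Empty using (⊥; ⊥-elim)
open import Function.Base using (_∘_; case_of_)
open import Function.Bundles using (_↔_; mk↔ₛ′; Injection)
open import Function.Properties.Inverse using (↔-refl; ↔-sym; ↔-trans; ↔⇒↣)
open import Data.Product.Function.Dependent.Propositional using (Σ-↔)
open import Data.Product.Function.NonDependent.Propositional using (_×-↔_)
open import Data.Sum.Function.Propositional using (_⊎-↔_)
open import Relation.Nullary using (¬_; yes; no)
import Relation.Nullary as Nullary
open import Relation.Binary.Bundles using (Setoid)
open import Relation.Binary.Definitions using (Irrelevant)
open import Relation.Binary.PropositionalEquality
import Relation.Binary.Reasoning.Setoid as SetoidReasoning
open import Axiom.UniquenessOfIdentityProofs using (module Decidable⇒UIP)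
open import Algebra.Structures using (IsCommutativeRing)

Vec↔Fin^ : ∀ {X : Set} {s} → X ↔ Fin s → ∀ m → Vec X m ↔ Fin (s ^ m)
Vec↔Fin^ X↔ zero =
  mk↔ₛ′ (λ _ → fzero) (λ _ → Vec.[]) (λ { fzero → refl ; (fsuc ()) }) (λ { Vec.[] → refl })
Vec↔Fin^ {X} X↔ (suc m) = ↔-trans uncons (↔-trans (X↔ ×-↔ Vec↔Fin^ X↔ m) (↔-sym Finₚ.*↔×))
  where
  uncons : Vec X (suc m) ↔ (X × Vec X m)
  uncons = mk↔ₛ′ (λ { (x Vec.∷ xs) → x , xs }) (λ (x , xs) → x Vec.∷ xs)
                 (λ _ → refl) (λ { (x Vec.∷ xs) → refl })

×-irrelevant : ∀ {A B : Set} → Nullary.Irrelevant A → Nullary.Irrelevant B → Nullary.Irrelevant (A × B)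
×-irrelevant irrA irrB (a , b) (a' , b') = cong₂ _,_ (irrA a a') (irrB b b')

Fin↔Fin⇒≡ : ∀ {m n} → Fin m ↔ Fin n → m ≡ n
Fin↔Fin⇒≡ m↔n = Finₚ.cantor-schröder-bernstein
  (Injection.injective (↔⇒↣ m↔n)) (Injection.injective (↔⇒↣ (↔-sym m↔n)))

-- With Q = q^(d+1), the count Q^(m+1) = N + q Q^m gives N = (q^d − 1) q Q^m.
count-closed-form : ∀ q d m k N → (q ^ suc d) ^ suc m ≡ N + q * (q ^ suc d) ^ m →
                    N * q ^ d * q ^ (k * suc d) ≡ (q ^ d ∸ 1) * q ^ ((suc m + k) * suc d)
count-closed-form q d m k N count = begin
  N * q ^ d * q ^ (k * suc d)                 ≡⟨ cong₂ (λ x y → x * q ^ d * y) N≡ (power k) ⟩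
  (q ^ d ∸ 1) * (q * Qᵐ) * q ^ d * Q ^ k      ≡⟨ regroup (q ^ d ∸ 1) q Qᵐ (q ^ d) (Q ^ k) ⟩
  (q ^ d ∸ 1) * (Q ^ suc m * Q ^ k)           ≡⟨ cong ((q ^ d ∸ 1) *_) (ℕP.^-distribˡ-+-* Q (suc m) k) ⟨
  (q ^ d ∸ 1) * Q ^ (suc m + k)               ≡⟨ cong ((q ^ d ∸ 1) *_) (power (suc m + k)) ⟨
  (q ^ d ∸ 1) * q ^ ((suc m + k) * suc d)     ∎
  where
  open ≡-Reasoning
  Q = q ^ suc d
  Qᵐ = Q ^ m
  power : ∀ j → q ^ (j * suc d) ≡ Q ^ j
  power j = trans (cong (q ^_) (ℕP.*-comm j (suc d))) (sym (ℕP.^-*-assoc q (suc d) j))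
  regroup : ∀ b q y a z → b * (q * y) * a * z ≡ b * ((q * a) * y * z)
  regroup = solve-∀
  N≡ : N ≡ (q ^ d ∸ 1) * (q * Qᵐ)
  N≡ = sym (begin
    (q ^ d ∸ 1) * (q * Qᵐ)          ≡⟨ ℕP.*-distribʳ-∸ (q * Qᵐ) (q ^ d) 1 ⟩
    q ^ d * (q * Qᵐ) ∸ 1 * (q * Qᵐ)  ≡⟨ cong₂ _∸_ (trans (swap (q ^ d) q Qᵐ) count)
                                                   (ℕP.*-identityˡ (q * Qᵐ)) ⟩
    N + q * Qᵐ ∸ q * Qᵐ              ≡⟨ ℕP.m+n∸n≡m N (q * Qᵐ) ⟩
    N                                ∎)
    where
    swap : ∀ a q y → a * (q * y) ≡ (q * a) * y
    swap = solve-∀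

module PolynomialArithmetic (𝔽 : FiniteField) where
  open FiniteField 𝔽 hiding (q) renaming (_+_ to infixl 6 _+F_; _*_ to infixl 7 _*F_; -_ to -F_)
  open IsCommutativeRing isCommutativeRing using
    ( +-comm; +-assoc; +-identityˡ; +-identityʳ; -‿inverseʳ
    ; *-comm; *-assoc; *-identityˡ; *-identityʳ; zeroˡ; zeroʳ; distribˡ; distribʳ)
  open Poly 𝔽

  x⁻¹*x≡1 : ∀ {x} → x ≢ 0# → x ⁻¹ *F x ≡ 1#
  x⁻¹*x≡1 {x} x≢0 = trans (*-comm _ _) (⁻¹-inverse x x≢0)

  x*y≢0 : ∀ {x y} → x ≢ 0# → y ≢ 0# → x *F y ≢ 0#
  x*y≢0 {x} {y} x≢0 y≢0 xy≡0 = y≢0 (begin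
    y                  ≡⟨ sym (*-identityˡ y) ⟩
    1# *F y            ≡⟨ cong (_*F y) (x⁻¹*x≡1 x≢0) ⟨
    x ⁻¹ *F x *F y     ≡⟨ *-assoc _ _ _ ⟩
    x ⁻¹ *F (x *F y)   ≡⟨ cong (x ⁻¹ *F_) xy≡0 ⟩
    x ⁻¹ *F 0#         ≡⟨ zeroʳ _ ⟩
    0#                 ∎)
    where open ≡-Reasoning

  x⁻¹≢0 : ∀ {x} → x ≢ 0# → x ⁻¹ ≢ 0#
  x⁻¹≢0 {x} x≢0 x⁻¹≡0 = 0≢1 (begin
    0#           ≡⟨ sym (zeroʳ x) ⟩
    x *F 0#      ≡⟨ cong (x *F_) (sym x⁻¹≡0) ⟩
    x *F x ⁻¹    ≡⟨ ⁻¹-inverse x x≢0 ⟩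
    1#           ∎)
    where open ≡-Reasoning

  x+-1*x≡0 : ∀ x → x +F (-F 1#) *F x ≡ 0#
  x+-1*x≡0 x = begin
    x +F (-F 1#) *F x          ≡⟨ cong (_+F (-F 1#) *F x) (sym (*-identityˡ x)) ⟩
    1# *F x +F (-F 1#) *F x    ≡⟨ sym (distribʳ x 1# (-F 1#)) ⟩
    (1# +F (-F 1#)) *F x       ≡⟨ cong (_*F x) (-‿inverseʳ 1#) ⟩
    0# *F x                    ≡⟨ zeroˡ x ⟩
    0#                         ∎
    where open ≡-Reasoning

  x+[y+z]≡y+[x+z] : ∀ x y z → x +F (y +F z) ≡ y +F (x +F z)
  x+[y+z]≡y+[x+z] x y z =
    trans (sym (+-assoc x y z)) (trans (cong (_+F z) (+-comm x y)) (+-assoc y x z))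

  [x+y]+[z+w]≡[x+z]+[y+w] : ∀ x y z w → (x +F y) +F (z +F w) ≡ (x +F z) +F (y +F w)
  [x+y]+[z+w]≡[x+z]+[y+w] x y z w = trans (+-assoc x y (z +F w))
    (trans (cong (x +F_) (x+[y+z]≡y+[x+z] y z w)) (sym (+-assoc x z (y +F w))))

  [y+z]-y≡z : ∀ y z → (y +F z) +F (-F 1#) *F y ≡ z
  [y+z]-y≡z y z = begin
    (y +F z) +F (-F 1#) *F y   ≡⟨ cong (_+F (-F 1#) *F y) (+-comm y z) ⟩
    (z +F y) +F (-F 1#) *F y   ≡⟨ +-assoc z y _ ⟩
    z +F (y +F (-F 1#) *F y)   ≡⟨ cong (z +F_) (x+-1*x≡0 y) ⟩
    z +F 0#                    ≡⟨ +-identityʳ z ⟩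
    z                          ∎
    where open ≡-Reasoning

  coef : P → ℕ → F
  coef []      _       = 0#
  coef (a ∷ p) zero    = a
  coef (a ∷ p) (suc i) = coef p i

  infix 4 _∼_
  record _∼_ (p r : P) : Set where
    constructor mk∼
    field at : ∀ i → coef p i ≡ coef r i
  open _∼_ public

  ∼-refl : ∀ {p} → p ∼ p
  ∼-refl = mk∼ λ _ → refl

  ∼-sym : ∀ {p r} → p ∼ r → r ∼ p
  ∼-sym e = mk∼ λ i → sym (at e i)

  ∼-trans : ∀ {p r s} → p ∼ r → r ∼ s → p ∼ s
  ∼-trans e f = mk∼ λ i → trans (at e i) (at f i)

  ∼-setoid : Setoid _ _
  ∼-setoid = record
    { Carrier = P ; _≈_ = _∼_
    ; isEquivalence = record { refl = ∼-refl ; sym = ∼-sym ; trans = ∼-trans } }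

  module ∼-Reasoning = SetoidReasoning ∼-setoid

  ∷-cong : ∀ {a p r} → p ∼ r → (a ∷ p) ∼ (a ∷ r)
  ∷-cong e = mk∼ λ { zero → refl ; (suc i) → at e i }

  ∷-injectiveʳ : ∀ {a b p r} → (a ∷ p) ∼ (b ∷ r) → p ∼ r
  ∷-injectiveʳ e = mk∼ λ i → at e (suc i)

  coef-0∷[] : ∀ i → coef (0# ∷ []) i ≡ 0#
  coef-0∷[] zero    = refl
  coef-0∷[] (suc i) = refl

  data NF : P → Set where
    nf[] : NF []
    nf1  : ∀ {a} → a ≢ 0# → NF (a ∷ [])
    nf∷  : ∀ {a b p} → NF (b ∷ p) → NF (a ∷ b ∷ p)

  NF-tail : ∀ {a p} → NF (a ∷ p) → NF p
  NF-tail (nf1 _) = nf[]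
  NF-tail (nf∷ n) = n

  coef-norm : ∀ p i → coef (norm p) i ≡ coef p i
  coef-norm [] i = refl
  coef-norm (a ∷ p) i with norm p | coef-norm p
  ... | [] | ih with a ≟ 0#
  ...   | yes a≡0 = zero-case i
    where zero-case : ∀ i → 0# ≡ coef (a ∷ p) i
          zero-case zero    = sym a≡0
          zero-case (suc i) = ih i
  ...   | no _ = const-case i
    where const-case : ∀ i → coef (a ∷ []) i ≡ coef (a ∷ p) i
          const-case zero    = refl
          const-case (suc i) = ih i
  coef-norm (a ∷ p) zero    | _ ∷ _ | ih = refl
  coef-norm (a ∷ p) (suc i) | _ ∷ _ | ih = ih i

  norm∼ : ∀ p → norm p ∼ p
  norm∼ p = mk∼ (coef-norm p)

  norm-NF : ∀ p → NF (norm p)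
  norm-NF [] = nf[]
  norm-NF (a ∷ p) with norm p | norm-NF p
  ... | [] | _ with a ≟ 0#
  ...   | yes _   = nf[]
  ...   | no a≢0 = nf1 a≢0
  norm-NF (a ∷ p) | _ ∷ _ | ih = nf∷ ih

  NF-∼⇒≡ : ∀ {p r} → NF p → NF r → p ∼ r → p ≡ r
  NF-∼⇒≡ nf[] nf[] e = refl
  NF-∼⇒≡ nf[] (nf1 b≢0) e = ⊥-elim (b≢0 (sym (at e 0)))
  NF-∼⇒≡ nf[] (nf∷ n) e with NF-∼⇒≡ nf[] n (mk∼ λ i → at e (suc i))
  ... | ()
  NF-∼⇒≡ (nf1 a≢0) nf[] e = ⊥-elim (a≢0 (at e 0))
  NF-∼⇒≡ (nf∷ n) nf[] e with NF-∼⇒≡ n nf[] (mk∼ λ i → at e (suc i))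
  ... | ()
  NF-∼⇒≡ {_ ∷ _} {_ ∷ _} np nr e =
    cong₂ _∷_ (at e 0) (NF-∼⇒≡ (NF-tail np) (NF-tail nr) (∷-injectiveʳ e))

  NF⇒norm≡ : ∀ {p} → NF p → norm p ≡ p
  NF⇒norm≡ {p} n = NF-∼⇒≡ (norm-NF p) n (norm∼ p)

  norm-cong : ∀ {p r} → p ∼ r → norm p ≡ norm r
  norm-cong {p} {r} e = NF-∼⇒≡ (norm-NF p) (norm-NF r)
    (∼-trans (norm∼ p) (∼-trans e (∼-sym (norm∼ r))))

  -- Size: degree + 1 for nonzero polynomials, 0 for the zero polynomial

  size : P → ℕ
  size p = length (norm p)

  size-NF : ∀ {p} → NF p → size p ≡ length p
  size-NF n = cong length (NF⇒norm≡ n)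

  size-norm : ∀ p → size (norm p) ≡ size p
  size-norm p = size-NF (norm-NF p)

  size-cong : ∀ {p r} → p ∼ r → size p ≡ size r
  size-cong e = cong length (norm-cong e)

  coef-≥length : ∀ p {i} → length p ≤ i → coef p i ≡ 0#
  coef-≥length []      _         = refl
  coef-≥length (a ∷ p) (s≤s len≤i) = coef-≥length p len≤i

  NF-coef-last≢0 : ∀ {p j} → NF p → length p ≡ suc j → coef p j ≢ 0#
  NF-coef-last≢0 {_ ∷ []}    {zero}  (nf1 a≢0) refl = a≢0
  NF-coef-last≢0 {_ ∷ _ ∷ _} {suc j} (nf∷ n)   e    = NF-coef-last≢0 n (ℕP.suc-injective e)

  coef-≥size : ∀ p {i} → size p ≤ i → coef p i ≡ 0#
  coef-≥size p {i} le = trans (sym (coef-norm p i)) (coef-≥length (norm p) le)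

  coef-top≢0 : ∀ p {j} → size p ≡ suc j → coef p j ≢ 0#
  coef-top≢0 p {j} e c = NF-coef-last≢0 (norm-NF p) e (trans (coef-norm p j) c)

  VanishesFrom : P → ℕ → Set
  VanishesFrom p m = ∀ i → m ≤ i → coef p i ≡ 0#

  size≤⇒VanishesFrom : ∀ p {m} → size p ≤ m → VanishesFrom p m
  size≤⇒VanishesFrom p size≤m i m≤i = coef-≥size p (ℕP.≤-trans size≤m m≤i)

  size-≤ : ∀ p m → VanishesFrom p m → size p ≤ m
  size-≤ p m vanish with size p ℕ.≤? m
  ... | yes le = le
  ... | no size≰m with size p in eq
  ...   | zero  = z≤n
  ...   | suc j = ⊥-elim (coef-top≢0 p eq (vanish j (ℕP.≤-pred (ℕP.≰⇒> size≰m))))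

  coef≢0⇒<size : ∀ p {i} → coef p i ≢ 0# → i < size p
  coef≢0⇒<size p {i} c≢0 with i <? size p
  ... | yes lt = lt
  ... | no ≮   = ⊥-elim (c≢0 (coef-≥size p (ℕP.≮⇒≥ ≮)))

  size≤length : ∀ p → size p ≤ length p
  size≤length p = size-≤ p (length p) (λ i → coef-≥length p)

  ∼[]⇒size≡0 : ∀ {p} → p ∼ [] → size p ≡ 0
  ∼[]⇒size≡0 = size-cong

  size≡0⇒∼[] : ∀ p → size p ≡ 0 → p ∼ []
  size≡0⇒∼[] p e = mk∼ λ i → coef-≥size p (subst (_≤ i) (sym e) z≤n)

  size≡suc⇒≁[] : ∀ {p k} → size p ≡ suc k → ¬ p ∼ []
  size≡suc⇒≁[] eq p∼[] with trans (sym eq) (∼[]⇒size≡0 p∼[])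
  ... | ()

  ≁[]⇒size≡suc : ∀ p → ¬ p ∼ [] → ∃ λ dp → size p ≡ suc dp
  ≁[]⇒size≡suc p p≁[] with size p in eq
  ... | zero   = ⊥-elim (p≁[] (size≡0⇒∼[] p eq))
  ... | suc dp = dp , refl

  one : P
  one = 1# ∷ []

  coef-add' : ∀ p r i → coef (add' p r) i ≡ coef p i +F coef r i
  coef-add' []      r       i       = sym (+-identityˡ _)
  coef-add' (a ∷ p) []      i       = sym (+-identityʳ _)
  coef-add' (a ∷ p) (b ∷ r) zero    = refl
  coef-add' (a ∷ p) (b ∷ r) (suc i) = coef-add' p r i

  coef-⊕ : ∀ p r i → coef (p ⊕ r) i ≡ coef p i +F coef r i
  coef-⊕ p r i = trans (coef-norm (add' p r) i) (coef-add' p r i)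

  coef-map : ∀ c p i → coef (map (c *F_) p) i ≡ c *F coef p i
  coef-map c []      i       = sym (zeroʳ c)
  coef-map c (a ∷ p) zero    = refl
  coef-map c (a ∷ p) (suc i) = coef-map c p i

  coef-scale : ∀ c p i → coef (scale c p) i ≡ c *F coef p i
  coef-scale c p i = trans (coef-norm (map (c *F_) p) i) (coef-map c p i)

  coef-neg : ∀ p i → coef (neg p) i ≡ (-F 1#) *F coef p i
  coef-neg = coef-scale (-F 1#)

  coef-∷-⊗ : ∀ a p r i → coef ((a ∷ p) ⊗ r) i ≡ a *F coef r i +F coef (0# ∷ (p ⊗ r)) i
  coef-∷-⊗ a p r i = trans (coef-⊕ (scale a r) (shift 1 (p ⊗ r)) i)
    (cong₂ _+F_ (coef-scale a r i) (coef-norm (0# ∷ (p ⊗ r)) i))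

  coef-0∷-⊕ : ∀ x y i → coef (0# ∷ (x ⊕ y)) i ≡ coef (0# ∷ x) i +F coef (0# ∷ y) i
  coef-0∷-⊕ x y zero    = sym (+-identityˡ 0#)
  coef-0∷-⊕ x y (suc i) = coef-⊕ x y i

  ⊕-cong : ∀ {p p' r r'} → p ∼ p' → r ∼ r' → (p ⊕ r) ∼ (p' ⊕ r')
  ⊕-cong {p} {p'} {r} {r'} e f = mk∼ λ i →
    trans (coef-⊕ p r i) (trans (cong₂ _+F_ (at e i) (at f i)) (sym (coef-⊕ p' r' i)))

  ⊕-congˡ : ∀ p {r r'} → r ∼ r' → (p ⊕ r) ∼ (p ⊕ r')
  ⊕-congˡ p = ⊕-cong (∼-refl {p})

  scale-cong : ∀ c {p p'} → p ∼ p' → scale c p ∼ scale c p'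
  scale-cong c {p} {p'} e = mk∼ λ i →
    trans (coef-scale c p i) (trans (cong (c *F_) (at e i)) (sym (coef-scale c p' i)))

  neg-cong : ∀ {p r} → p ∼ r → neg p ∼ neg r
  neg-cong = scale-cong (-F 1#)

  ⊕-identityˡ : ∀ p → ([] ⊕ p) ∼ p
  ⊕-identityˡ p = mk∼ λ i → trans (coef-⊕ [] p i) (+-identityˡ _)

  ⊕-identityʳ : ∀ p → (p ⊕ []) ∼ p
  ⊕-identityʳ p = mk∼ λ i → trans (coef-⊕ p [] i) (+-identityʳ _)

  ⊕-inverseʳ : ∀ p → (p ⊕ neg p) ∼ []
  ⊕-inverseʳ p = mk∼ λ i →
    trans (coef-⊕ p (neg p) i) (trans (cong (coef p i +F_) (coef-neg p i)) (x+-1*x≡0 _))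

  ⊗-congʳ : ∀ p {r r'} → r ∼ r' → (p ⊗ r) ∼ (p ⊗ r')
  ⊗-congʳ []      e = ∼-refl
  ⊗-congʳ (a ∷ p) {r} {r'} e = mk∼ λ i → trans (coef-∷-⊗ a p r i) (trans
    (cong₂ _+F_ (cong (a *F_) (at e i)) (at (∷-cong (⊗-congʳ p e)) i)) (sym (coef-∷-⊗ a p r' i)))

  ⊗-zeroˡ : ∀ p r → p ∼ [] → (p ⊗ r) ∼ []
  ⊗-zeroˡ []      r e = ∼-refl
  ⊗-zeroˡ (a ∷ p) r e = mk∼ λ i → begin
    coef ((a ∷ p) ⊗ r) i                       ≡⟨ coef-∷-⊗ a p r i ⟩
    a *F coef r i +F coef (0# ∷ (p ⊗ r)) i
      ≡⟨ cong₂ _+F_ (trans (cong (_*F coef r i) (at e 0)) (zeroˡ _))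
                    (at (∷-cong (⊗-zeroˡ p r (mk∼ λ j → at e (suc j)))) i) ⟩
    0# +F coef (0# ∷ []) i                     ≡⟨ trans (+-identityˡ _) (coef-0∷[] i) ⟩
    0#                                         ∎
    where open ≡-Reasoning

  ⊗-zeroʳ : ∀ p → (p ⊗ []) ∼ []
  ⊗-zeroʳ []      = ∼-refl
  ⊗-zeroʳ (a ∷ p) = mk∼ λ i → trans (coef-∷-⊗ a p [] i)
    (trans (cong₂ _+F_ (zeroʳ a) (at (∷-cong (⊗-zeroʳ p)) i)) (trans (+-identityˡ _) (coef-0∷[] i)))

  ⊗-congˡ : ∀ {p p'} r → p ∼ p' → (p ⊗ r) ∼ (p' ⊗ r)
  ⊗-congˡ {[]}    {p'}     r e = ∼-sym (⊗-zeroˡ p' r (∼-sym e))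
  ⊗-congˡ {a ∷ p} {[]}     r e = ⊗-zeroˡ (a ∷ p) r e
  ⊗-congˡ {a ∷ p} {b ∷ p'} r e = mk∼ λ i → trans (coef-∷-⊗ a p r i) (trans
    (cong₂ _+F_ (cong (_*F coef r i) (at e 0)) (at (∷-cong (⊗-congˡ r (∷-injectiveʳ e))) i))
    (sym (coef-∷-⊗ b p' r i)))

  ∷-⊗ : ∀ a p r → ((a ∷ p) ⊗ r) ∼ (scale a r ⊕ (0# ∷ (p ⊗ r)))
  ∷-⊗ a p r = mk∼ λ i → trans (coef-∷-⊗ a p r i)
    (sym (trans (coef-⊕ (scale a r) _ i) (cong (_+F coef (0# ∷ (p ⊗ r)) i) (coef-scale a r i))))

  ⊗-∷ : ∀ p b r → (p ⊗ (b ∷ r)) ∼ (scale b p ⊕ (0# ∷ (p ⊗ r)))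
  ⊗-∷ [] b r = mk∼ λ i → sym (begin
    coef (scale b [] ⊕ (0# ∷ [])) i          ≡⟨ coef-⊕ (scale b []) (0# ∷ []) i ⟩
    coef (scale b []) i +F coef (0# ∷ []) i  ≡⟨ cong₂ _+F_ (coef-scale b [] i) (coef-0∷[] i) ⟩
    b *F 0# +F 0#                            ≡⟨ trans (+-identityʳ _) (zeroʳ b) ⟩
    0#                                       ∎)
    where open ≡-Reasoning
  ⊗-∷ (a ∷ p) b r = mk∼ coefs
    where
    open ≡-Reasoning
    coefs : ∀ i → coef ((a ∷ p) ⊗ (b ∷ r)) i ≡ coef (scale b (a ∷ p) ⊕ (0# ∷ ((a ∷ p) ⊗ r))) i
    coefs zero = begin
      coef ((a ∷ p) ⊗ (b ∷ r)) 0          ≡⟨ coef-∷-⊗ a p (b ∷ r) 0 ⟩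
      a *F b +F 0#                        ≡⟨ cong (_+F 0#) (*-comm a b) ⟩
      b *F a +F 0#                        ≡⟨ cong (_+F 0#) (sym (coef-scale b (a ∷ p) 0)) ⟩
      coef (scale b (a ∷ p)) 0 +F 0#      ≡⟨ sym (coef-⊕ (scale b (a ∷ p)) _ 0) ⟩
      coef (scale b (a ∷ p) ⊕ (0# ∷ ((a ∷ p) ⊗ r))) 0 ∎
    coefs (suc i) = begin
      coef ((a ∷ p) ⊗ (b ∷ r)) (suc i)
        ≡⟨ coef-∷-⊗ a p (b ∷ r) (suc i) ⟩
      a *F coef r i +F coef (p ⊗ (b ∷ r)) i
        ≡⟨ cong (a *F coef r i +F_) (trans (at (⊗-∷ p b r) i) (coef-⊕ (scale b p) _ i)) ⟩
      a *F coef r i +F (coef (scale b p) i +F coef (0# ∷ (p ⊗ r)) i)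
        ≡⟨ x+[y+z]≡y+[x+z] _ _ _ ⟩
      coef (scale b p) i +F (a *F coef r i +F coef (0# ∷ (p ⊗ r)) i)
        ≡⟨ cong₂ _+F_ (trans (coef-scale b p i) (sym (coef-scale b (a ∷ p) (suc i))))
                      (sym (coef-∷-⊗ a p r i)) ⟩
      coef (scale b (a ∷ p)) (suc i) +F coef ((a ∷ p) ⊗ r) i
        ≡⟨ sym (coef-⊕ (scale b (a ∷ p)) _ (suc i)) ⟩
      coef (scale b (a ∷ p) ⊕ (0# ∷ ((a ∷ p) ⊗ r))) (suc i) ∎

  ⊗-comm : ∀ p r → (p ⊗ r) ∼ (r ⊗ p)
  ⊗-comm []      r = ∼-sym (⊗-zeroʳ r)
  ⊗-comm (a ∷ p) r = begin
    (a ∷ p) ⊗ r                     ≈⟨ ∷-⊗ a p r ⟩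
    scale a r ⊕ (0# ∷ (p ⊗ r))      ≈⟨ ⊕-congˡ (scale a r) (∷-cong (⊗-comm p r)) ⟩
    scale a r ⊕ (0# ∷ (r ⊗ p))      ≈⟨ ⊗-∷ r a p ⟨
    r ⊗ (a ∷ p)                     ∎
    where open ∼-Reasoning

  ⊗-distribˡ : ∀ p r s → (p ⊗ (r ⊕ s)) ∼ ((p ⊗ r) ⊕ (p ⊗ s))
  ⊗-distribˡ [] r s = mk∼ λ i → sym (trans (coef-⊕ [] [] i) (+-identityˡ _))
  ⊗-distribˡ (a ∷ p) r s = mk∼ λ i → begin
    coef ((a ∷ p) ⊗ (r ⊕ s)) i
      ≡⟨ coef-∷-⊗ a p (r ⊕ s) i ⟩
    a *F coef (r ⊕ s) i +F coef (0# ∷ (p ⊗ (r ⊕ s))) i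
      ≡⟨ cong₂ _+F_ (trans (cong (a *F_) (coef-⊕ r s i)) (distribˡ a _ _))
                    (trans (at (∷-cong (⊗-distribˡ p r s)) i) (coef-0∷-⊕ (p ⊗ r) (p ⊗ s) i)) ⟩
    (a *F coef r i +F a *F coef s i) +F (coef (0# ∷ (p ⊗ r)) i +F coef (0# ∷ (p ⊗ s)) i)
      ≡⟨ [x+y]+[z+w]≡[x+z]+[y+w] _ _ _ _ ⟩
    (a *F coef r i +F coef (0# ∷ (p ⊗ r)) i) +F (a *F coef s i +F coef (0# ∷ (p ⊗ s)) i)
      ≡⟨ cong₂ _+F_ (sym (coef-∷-⊗ a p r i)) (sym (coef-∷-⊗ a p s i)) ⟩
    coef ((a ∷ p) ⊗ r) i +F coef ((a ∷ p) ⊗ s) i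
      ≡⟨ sym (coef-⊕ ((a ∷ p) ⊗ r) ((a ∷ p) ⊗ s) i) ⟩
    coef (((a ∷ p) ⊗ r) ⊕ ((a ∷ p) ⊗ s)) i ∎
    where open ≡-Reasoning

  ⊗-distribʳ : ∀ p r s → ((p ⊕ r) ⊗ s) ∼ ((p ⊗ s) ⊕ (r ⊗ s))
  ⊗-distribʳ p r s = ∼-trans (⊗-comm (p ⊕ r) s)
    (∼-trans (⊗-distribˡ s p r) (⊕-cong (⊗-comm s p) (⊗-comm s r)))

  map-⊗ : ∀ a r s → (map (a *F_) r ⊗ s) ∼ scale a (r ⊗ s)
  map-⊗ a [] s = mk∼ λ i → sym (trans (coef-scale a [] i) (zeroʳ a))
  map-⊗ a (b ∷ r) s = mk∼ λ i → begin
    coef ((a *F b ∷ map (a *F_) r) ⊗ s) i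
      ≡⟨ coef-∷-⊗ (a *F b) (map (a *F_) r) s i ⟩
    a *F b *F coef s i +F coef (0# ∷ (map (a *F_) r ⊗ s)) i
      ≡⟨ cong₂ _+F_ (*-assoc a b _) (trans (at (∷-cong (map-⊗ a r s)) i) (scaled-tail i)) ⟩
    a *F (b *F coef s i) +F a *F coef (0# ∷ (r ⊗ s)) i
      ≡⟨ sym (distribˡ a _ _) ⟩
    a *F (b *F coef s i +F coef (0# ∷ (r ⊗ s)) i)
      ≡⟨ cong (a *F_) (sym (coef-∷-⊗ b r s i)) ⟩
    a *F coef ((b ∷ r) ⊗ s) i
      ≡⟨ sym (coef-scale a ((b ∷ r) ⊗ s) i) ⟩
    coef (scale a ((b ∷ r) ⊗ s)) i ∎
    where
    open ≡-Reasoning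
    scaled-tail : ∀ i → coef (0# ∷ scale a (r ⊗ s)) i ≡ a *F coef (0# ∷ (r ⊗ s)) i
    scaled-tail zero    = sym (zeroʳ a)
    scaled-tail (suc i) = coef-scale a (r ⊗ s) i

  scale-⊗ : ∀ a r s → (scale a r ⊗ s) ∼ scale a (r ⊗ s)
  scale-⊗ a r s = ∼-trans (⊗-congˡ s (norm∼ (map (a *F_) r))) (map-⊗ a r s)

  neg-⊗ : ∀ p r → (neg p ⊗ r) ∼ neg (p ⊗ r)
  neg-⊗ = scale-⊗ (-F 1#)

  ⊗-neg : ∀ p r → (p ⊗ neg r) ∼ neg (p ⊗ r)
  ⊗-neg p r = ∼-trans (⊗-comm p (neg r)) (∼-trans (neg-⊗ r p) (neg-cong (⊗-comm r p)))

  0∷-⊗ : ∀ x s → ((0# ∷ x) ⊗ s) ∼ (0# ∷ (x ⊗ s))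
  0∷-⊗ x s = mk∼ λ i → trans (coef-∷-⊗ 0# x s i)
    (trans (cong (_+F coef (0# ∷ (x ⊗ s)) i) (zeroˡ _)) (+-identityˡ _))

  ⊗-assoc : ∀ p r s → ((p ⊗ r) ⊗ s) ∼ (p ⊗ (r ⊗ s))
  ⊗-assoc []      r s = ∼-refl
  ⊗-assoc (a ∷ p) r s = begin
    ((a ∷ p) ⊗ r) ⊗ s                            ≈⟨ ⊗-congˡ s (∷-⊗ a p r) ⟩
    (scale a r ⊕ (0# ∷ (p ⊗ r))) ⊗ s             ≈⟨ ⊗-distribʳ (scale a r) (0# ∷ (p ⊗ r)) s ⟩
    (scale a r ⊗ s) ⊕ ((0# ∷ (p ⊗ r)) ⊗ s)       ≈⟨ ⊕-cong (scale-⊗ a r s) (0∷-⊗ (p ⊗ r) s) ⟩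
    scale a (r ⊗ s) ⊕ (0# ∷ ((p ⊗ r) ⊗ s))
      ≈⟨ ⊕-congˡ (scale a (r ⊗ s)) (∷-cong (⊗-assoc p r s)) ⟩
    scale a (r ⊗ s) ⊕ (0# ∷ (p ⊗ (r ⊗ s)))       ≈⟨ ∷-⊗ a p (r ⊗ s) ⟨
    (a ∷ p) ⊗ (r ⊗ s)                            ∎
    where open ∼-Reasoning

  ⊗-identityˡ : ∀ p → (one ⊗ p) ∼ p
  ⊗-identityˡ p = mk∼ λ i → begin
    coef (one ⊗ p) i                       ≡⟨ coef-∷-⊗ 1# [] p i ⟩
    1# *F coef p i +F coef (0# ∷ []) i     ≡⟨ cong₂ _+F_ (*-identityˡ _) (coef-0∷[] i) ⟩
    coef p i +F 0#                         ≡⟨ +-identityʳ _ ⟩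
    coef p i                               ∎
    where open ≡-Reasoning

  ⊗-identityʳ : ∀ p → (p ⊗ one) ∼ p
  ⊗-identityʳ p = ∼-trans (⊗-comm p one) (⊗-identityˡ p)

  ⊗-[c] : ∀ p c → (p ⊗ (c ∷ [])) ∼ scale c p
  ⊗-[c] p c = ∼-trans (⊗-∷ p c []) (∼-trans (⊕-congˡ (scale c p) (∷-cong (⊗-zeroʳ p)))
    (mk∼ λ i → trans (coef-⊕ (scale c p) (0# ∷ []) i)
      (trans (cong (coef (scale c p) i +F_) (coef-0∷[] i)) (+-identityʳ _))))

  NF-⊕ : ∀ p r → NF (p ⊕ r)
  NF-⊕ p r = norm-NF (add' p r)

  NF-scale : ∀ c p → NF (scale c p)
  NF-scale c p = norm-NF (map (c *F_) p)

  NF-⊗ : ∀ p r → NF (p ⊗ r)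
  NF-⊗ []      r = nf[]
  NF-⊗ (a ∷ p) r = NF-⊕ (scale a r) (shift 1 (p ⊗ r))

  ⊕-leftcomm : ∀ p r s → (p ⊕ (r ⊕ s)) ∼ (r ⊕ (p ⊕ s))
  ⊕-leftcomm p r s = mk∼ λ i → begin
    coef (p ⊕ (r ⊕ s)) i                 ≡⟨ trans (coef-⊕ p _ i) (cong (coef p i +F_) (coef-⊕ r s i)) ⟩
    coef p i +F (coef r i +F coef s i)   ≡⟨ x+[y+z]≡y+[x+z] _ _ _ ⟩
    coef r i +F (coef p i +F coef s i)   ≡⟨ sym (trans (coef-⊕ r _ i) (cong (coef r i +F_) (coef-⊕ p s i))) ⟩
    coef (r ⊕ (p ⊕ s)) i                 ∎
    where open ≡-Reasoning

  ⊕-neg∼[]⇒∼ : ∀ p r → (p ⊕ neg r) ∼ [] → p ∼ r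
  ⊕-neg∼[]⇒∼ p r p-r∼[] = mk∼ λ i → begin
    coef p i                                         ≡⟨ sym ([y+z]-y≡z (coef r i) (coef p i)) ⟩
    (coef r i +F coef p i) +F (-F 1#) *F coef r i    ≡⟨ +-assoc _ _ _ ⟩
    coef r i +F (coef p i +F (-F 1#) *F coef r i)    ≡⟨ cong (coef r i +F_) (difference i) ⟩
    coef r i +F 0#                                   ≡⟨ +-identityʳ _ ⟩
    coef r i                                         ∎
    where
    open ≡-Reasoning
    difference : ∀ i → coef p i +F (-F 1#) *F coef r i ≡ 0#
    difference i = trans (sym (trans (coef-⊕ p (neg r) i) (cong (coef p i +F_) (coef-neg r i)))) (at p-r∼[] i)

  ∷-⊗-tail≡0 : ∀ {a} p r → VanishesFrom (a ∷ p) 1 → ∀ i → coef (0# ∷ (p ⊗ r)) i ≡ 0#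
  ∷-⊗-tail≡0 p r vp i = trans (at (∷-cong (⊗-zeroˡ p r (mk∼ λ j → vp (suc j) (s≤s z≤n)))) i) (coef-0∷[] i)

  ⊗-vanishesFrom : ∀ p r dp dr → VanishesFrom p (suc dp) → VanishesFrom r (suc dr) →
                   VanishesFrom (p ⊗ r) (suc (dp + dr))
  ⊗-vanishesFrom []      r dp       dr vp vr i _ = refl
  ⊗-vanishesFrom (a ∷ p) r zero     dr vp vr i dr<i = begin
    coef ((a ∷ p) ⊗ r) i                     ≡⟨ coef-∷-⊗ a p r i ⟩
    a *F coef r i +F coef (0# ∷ (p ⊗ r)) i   ≡⟨ cong₂ _+F_ (trans (cong (a *F_) (vr i dr<i)) (zeroʳ a))
                                                           (∷-⊗-tail≡0 p r vp i) ⟩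
    0# +F 0#                                 ≡⟨ +-identityˡ 0# ⟩
    0#                                       ∎
    where open ≡-Reasoning
  ⊗-vanishesFrom (a ∷ p) r (suc dp) dr vp vr (suc i) (s≤s dp+dr<i) = begin
    coef ((a ∷ p) ⊗ r) (suc i)               ≡⟨ coef-∷-⊗ a p r (suc i) ⟩
    a *F coef r (suc i) +F coef (p ⊗ r) i    ≡⟨ cong₂ _+F_ (trans (cong (a *F_) (vr (suc i) dr<1+i)) (zeroʳ a))
                                                           (⊗-vanishesFrom p r dp dr vp' vr i dp+dr<i) ⟩
    0# +F 0#                                 ≡⟨ +-identityˡ 0# ⟩
    0#                                       ∎
    where
    open ≡-Reasoning
    dr<1+i : suc dr ≤ suc i
    dr<1+i = ℕP.≤-trans (s≤s (ℕP.m≤n+m dr dp)) (ℕP.m≤n⇒m≤1+n dp+dr<i)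
    vp' : VanishesFrom p (suc dp)
    vp' j j>dp = vp (suc j) (s≤s j>dp)

  coef-⊗-top : ∀ p r dp dr → VanishesFrom p (suc dp) → VanishesFrom r (suc dr) →
               coef (p ⊗ r) (dp + dr) ≡ coef p dp *F coef r dr
  coef-⊗-top []      r dp       dr vp vr = sym (zeroˡ _)
  coef-⊗-top (a ∷ p) r zero     dr vp vr = begin
    coef ((a ∷ p) ⊗ r) dr                     ≡⟨ coef-∷-⊗ a p r dr ⟩
    a *F coef r dr +F coef (0# ∷ (p ⊗ r)) dr  ≡⟨ cong (a *F coef r dr +F_) (∷-⊗-tail≡0 p r vp dr) ⟩
    a *F coef r dr +F 0#                      ≡⟨ +-identityʳ _ ⟩
    a *F coef r dr                            ∎
    where open ≡-Reasoning
  coef-⊗-top (a ∷ p) r (suc dp) dr vp vr = begin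
    coef ((a ∷ p) ⊗ r) (suc (dp + dr))               ≡⟨ coef-∷-⊗ a p r (suc (dp + dr)) ⟩
    a *F coef r (suc (dp + dr)) +F coef (p ⊗ r) (dp + dr)
      ≡⟨ cong₂ _+F_ (trans (cong (a *F_) (vr _ (s≤s (ℕP.m≤n+m dr dp)))) (zeroʳ a))
                    (coef-⊗-top p r dp dr (λ j j>dp → vp (suc j) (s≤s j>dp)) vr) ⟩
    0# +F coef p dp *F coef r dr                     ≡⟨ +-identityˡ _ ⟩
    coef p dp *F coef r dr                           ∎
    where open ≡-Reasoning

  size-⊗ : ∀ p r {dp dr} → size p ≡ suc dp → size r ≡ suc dr → size (p ⊗ r) ≡ suc (dp + dr)
  size-⊗ p r {dp} {dr} sp sr = ℕP.≤-antisym
    (size-≤ (p ⊗ r) _ (⊗-vanishesFrom p r dp dr vp vr))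
    (coef≢0⇒<size (p ⊗ r) λ top≡0 →
      x*y≢0 (coef-top≢0 p sp) (coef-top≢0 r sr) (trans (sym (coef-⊗-top p r dp dr vp vr)) top≡0))
    where
    vp = size≤⇒VanishesFrom p (ℕP.≤-reflexive sp)
    vr = size≤⇒VanishesFrom r (ℕP.≤-reflexive sr)

  coef-⊗-leading : ∀ p r {dp dr} → size p ≡ suc dp → size r ≡ suc dr →
                   coef (p ⊗ r) (dp + dr) ≡ coef p dp *F coef r dr
  coef-⊗-leading p r {dp} {dr} sp sr = coef-⊗-top p r dp dr
    (size≤⇒VanishesFrom p (ℕP.≤-reflexive sp)) (size≤⇒VanishesFrom r (ℕP.≤-reflexive sr))

  ⊗-≁[] : ∀ p r → ¬ p ∼ [] → ¬ r ∼ [] → ¬ (p ⊗ r) ∼ []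
  ⊗-≁[] p r p≁[] r≁[] with ≁[]⇒size≡suc p p≁[] | ≁[]⇒size≡suc r r≁[]
  ... | _ , sp | _ , sr = size≡suc⇒≁[] (size-⊗ p r sp sr)

  ⊗-cancelˡ : ∀ c {x y} → ¬ c ∼ [] → (c ⊗ x) ∼ (c ⊗ y) → x ∼ y
  ⊗-cancelˡ c {x} {y} c≁[] cx∼cy with size (x ⊕ neg y) in eq
  ... | zero  = ⊕-neg∼[]⇒∼ x y (size≡0⇒∼[] _ eq)
  ... | suc _ = ⊥-elim (⊗-≁[] c (x ⊕ neg y) c≁[] (size≡suc⇒≁[] eq) c[x-y]∼[])
    where
    open ∼-Reasoning
    c[x-y]∼[] : (c ⊗ (x ⊕ neg y)) ∼ []
    c[x-y]∼[] = begin
      c ⊗ (x ⊕ neg y)               ≈⟨ ⊗-distribˡ c x (neg y) ⟩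
      (c ⊗ x) ⊕ (c ⊗ neg y)         ≈⟨ ⊕-cong cx∼cy (⊗-neg c y) ⟩
      (c ⊗ y) ⊕ neg (c ⊗ y)         ≈⟨ ⊕-inverseʳ (c ⊗ y) ⟩
      []                            ∎

  -- Division with remainder

  last≡coef : ∀ l {j} → length l ≡ suc j → last l ≡ just (coef l j)
  last≡coef (x ∷ [])     {zero}  refl = refl
  last≡coef (x ∷ y ∷ xs) {suc j} e    = last≡coef (y ∷ xs) (ℕP.suc-injective e)

  lead≡coef : ∀ p {dp} → size p ≡ suc dp → lead p ≡ coef p dp
  lead≡coef p {dp} e with last (norm p) | last≡coef (norm p) e
  ... | just _ | refl = coef-norm p dp

  coef-shift : ∀ m y j → coef (shift m y) (m + j) ≡ coef y j
  coef-shift zero    y j = refl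
  coef-shift (suc m) y j = trans (coef-norm (0# ∷ shift m y) (suc (m + j))) (coef-shift m y j)

  shift-vanishesFrom : ∀ m y {k} → VanishesFrom y k → VanishesFrom (shift m y) (m + k)
  shift-vanishesFrom m y {k} vy i m+k≤i = begin
    coef (shift m y) i
      ≡⟨ cong (coef (shift m y)) (sym (ℕP.m+[n∸m]≡n (ℕP.m+n≤o⇒m≤o m m+k≤i))) ⟩
    coef (shift m y) (m + (i ∸ m))
      ≡⟨ coef-shift m y (i ∸ m) ⟩
    coef y (i ∸ m)
      ≡⟨ vy (i ∸ m) (ℕP.m+n≤o⇒m≤o∸n k (subst (_≤ i) (ℕP.+-comm m k) m+k≤i)) ⟩
    0# ∎
    where open ≡-Reasoning

  divStep-size : ∀ b r {db dr} → size b ≡ suc db → size r ≡ suc dr → db ≤ dr →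
    size (r ⊕ neg (shift (size r ∸ size b) ((lead r *F lead b ⁻¹) ∷ []) ⊗ b)) ≤ dr
  divStep-size b r {db} {dr} sb sr db≤dr = size-≤ r' dr vanish
    where
    open ≡-Reasoning
    c = lead r *F lead b ⁻¹
    m = size r ∸ size b
    t = shift m (c ∷ [])
    r' = r ⊕ neg (t ⊗ b)
    m+db≡dr : m + db ≡ dr
    m+db≡dr = trans (cong (_+ db) (cong₂ _∸_ sr sb)) (ℕP.m∸n+n≡m db≤dr)
    vt : VanishesFrom t (suc m)
    vt = subst (VanishesFrom t) (ℕP.+-comm m 1) (shift-vanishesFrom m (c ∷ []) λ { zero () ; (suc j) _ → refl })
    vb : VanishesFrom b (suc db)
    vb = size≤⇒VanishesFrom b (ℕP.≤-reflexive sb)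
    coef-r' : ∀ i → coef r' i ≡ coef r i +F (-F 1#) *F coef (t ⊗ b) i
    coef-r' i = trans (coef-⊕ r _ i) (cong (coef r i +F_) (coef-neg (t ⊗ b) i))
    lead-tb : coef (t ⊗ b) dr ≡ coef r dr
    lead-tb = begin
      coef (t ⊗ b) dr                 ≡⟨ cong (coef (t ⊗ b)) (sym m+db≡dr) ⟩
      coef (t ⊗ b) (m + db)           ≡⟨ coef-⊗-top t b m db vt vb ⟩
      coef t m *F coef b db           ≡⟨ cong₂ _*F_ (trans (cong (coef t) (sym (ℕP.+-identityʳ m))) (coef-shift m _ 0))
                                                    (sym (lead≡coef b sb)) ⟩
      lead r *F lead b ⁻¹ *F lead b   ≡⟨ *-assoc _ _ _ ⟩
      lead r *F (lead b ⁻¹ *F lead b) ≡⟨ cong (lead r *F_) (x⁻¹*x≡1 lead-b≢0) ⟩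
      lead r *F 1#                    ≡⟨ trans (*-identityʳ _) (lead≡coef r sr) ⟩
      coef r dr                       ∎
      where
      lead-b≢0 : lead b ≢ 0#
      lead-b≢0 e = coef-top≢0 b sb (trans (sym (lead≡coef b sb)) e)
    vanish : VanishesFrom r' dr
    vanish i dr≤i with dr ℕP.≟ i
    ... | yes refl = trans (coef-r' dr) (trans (cong (λ z → z +F (-F 1#) *F coef (t ⊗ b) dr) (sym lead-tb))
                       (x+-1*x≡0 _))
    ... | no dr≢i = trans (coef-r' i) (trans (cong₂ (λ u v → u +F (-F 1#) *F v) ri tbi)
                       (trans (+-identityˡ _) (zeroʳ _)))
      where
      dr<i = ℕP.≤∧≢⇒< dr≤i dr≢i
      ri : coef r i ≡ 0#
      ri = size≤⇒VanishesFrom r (ℕP.≤-reflexive sr) i dr<i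
      tbi : coef (t ⊗ b) i ≡ 0#
      tbi = ⊗-vanishesFrom t b m db vt vb i (subst (_< i) (sym m+db≡dr) dr<i)

  divStep-spec : ∀ fuel b r qu x {db} → size b ≡ suc db → size r ≤ fuel + db → NF qu →
    let (qu' , r') = divStep (suc fuel) b r (qu , x) in
    (((qu ⊗ b) ⊕ r) ∼ ((qu' ⊗ b) ⊕ r')) × (size r' < size b) × NF qu'
  divStep-spec fuel b r qu x sb size-r≤ nf-qu with length (norm r) <? length (norm b)
  ... | yes r<b = ⊕-congˡ (qu ⊗ b) (∼-sym (norm∼ r)) , subst (_< size b) (sym (size-norm r)) r<b , nf-qu
  divStep-spec zero b r qu x sb size-r≤ nf-qu | no r≮b =
    ⊥-elim (r≮b (subst (size r <_) (sym sb) (s≤s size-r≤)))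
  divStep-spec (suc fuel) b r qu x {db} sb size-r≤ nf-qu | no r≮b =
    ∼-trans invariant (proj₁ rest) , proj₂ rest
    where
    b≤r = ℕP.≮⇒≥ r≮b
    dr = ℕ.pred (size r)
    sr : size r ≡ suc dr
    sr = sym (ℕP.suc-pred (size r) ⦃ ℕ.>-nonZero (ℕP.<-≤-trans (subst (0 <_) (sym sb) (s≤s z≤n)) b≤r) ⦄)
    t = shift (size r ∸ size b) ((lead r *F lead b ⁻¹) ∷ [])
    r' = r ⊕ neg (t ⊗ b)
    size-r'≤ : size r' ≤ fuel + db
    size-r'≤ = ℕP.≤-trans (divStep-size b r sb sr (ℕP.≤-pred (subst₂ _≤_ sb sr b≤r)))
                          (ℕP.≤-pred (subst (_≤ suc fuel + db) sr size-r≤))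
    rest = divStep-spec fuel b r' (qu ⊕ t) [] sb size-r'≤ (NF-⊕ qu t)
    invariant : ((qu ⊗ b) ⊕ r) ∼ (((qu ⊕ t) ⊗ b) ⊕ r')
    invariant = mk∼ λ i → sym (begin
      coef (((qu ⊕ t) ⊗ b) ⊕ r') i
        ≡⟨ coef-⊕ ((qu ⊕ t) ⊗ b) r' i ⟩
      coef ((qu ⊕ t) ⊗ b) i +F coef r' i
        ≡⟨ cong₂ _+F_ (trans (at (⊗-distribʳ qu t b) i) (coef-⊕ (qu ⊗ b) (t ⊗ b) i))
                      (trans (coef-⊕ r _ i) (cong (coef r i +F_) (coef-neg (t ⊗ b) i))) ⟩
      (coef (qu ⊗ b) i +F coef (t ⊗ b) i) +F (coef r i +F (-F 1#) *F coef (t ⊗ b) i)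
        ≡⟨ [x+y]+[z+w]≡[x+z]+[y+w] _ _ _ _ ⟩
      (coef (qu ⊗ b) i +F coef r i) +F (coef (t ⊗ b) i +F (-F 1#) *F coef (t ⊗ b) i)
        ≡⟨ cong ((coef (qu ⊗ b) i +F coef r i) +F_) (x+-1*x≡0 _) ⟩
      (coef (qu ⊗ b) i +F coef r i) +F 0#
        ≡⟨ +-identityʳ _ ⟩
      coef (qu ⊗ b) i +F coef r i
        ≡⟨ sym (coef-⊕ (qu ⊗ b) r i) ⟩
      coef ((qu ⊗ b) ⊕ r) i ∎)
      where open ≡-Reasoning

  quotRem-spec : ∀ p b {db} → size b ≡ suc db →
    (p ∼ ((quot p b ⊗ b) ⊕ rem p b)) × (size (rem p b) < size b) × NF (quot p b)
  quotRem-spec p b {db} sb =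
    ∼-trans (∼-sym (∼-trans (⊕-identityˡ (norm p)) (norm∼ p))) (proj₁ spec) , proj₂ spec
    where
    size-p≤ : size (norm p) ≤ length p + db
    size-p≤ = ℕP.≤-trans (ℕP.≤-reflexive (size-norm p)) (ℕP.≤-trans (size≤length p) (ℕP.m≤m+n _ _))
    spec = divStep-spec (length p) b (norm p) [] (norm p) sb size-p≤ nf[]

  ⊕-neg-cancelˡ : ∀ x y → ((x ⊕ y) ⊕ neg x) ∼ y
  ⊕-neg-cancelˡ x y = mk∼ λ i → begin
    coef ((x ⊕ y) ⊕ neg x) i                       ≡⟨ coef-⊕ (x ⊕ y) (neg x) i ⟩
    coef (x ⊕ y) i +F coef (neg x) i               ≡⟨ cong₂ _+F_ (coef-⊕ x y i) (coef-neg x i) ⟩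
    (coef x i +F coef y i) +F (-F 1#) *F coef x i  ≡⟨ [y+z]-y≡z (coef x i) (coef y i) ⟩
    coef y i                                       ∎
    where open ≡-Reasoning

  size-⊗<⇒∼[] : ∀ d c → size (d ⊗ c) < size c → d ∼ []
  size-⊗<⇒∼[] d c lt with size d in sd | size c in sc
  ... | zero   | _      = size≡0⇒∼[] d sd
  ... | suc dd | suc dc =
    ⊥-elim (ℕP.<⇒≱ lt (subst (suc dc ≤_) (sym (size-⊗ d c sd sc)) (s≤s (ℕP.m≤n+m dc dd))))

  quot-exact : ∀ p c u {dc} → size c ≡ suc dc → p ∼ (u ⊗ c) → quot p c ∼ u
  quot-exact p c u sc p∼uc = ∼-sym (⊕-neg∼[]⇒∼ u Q (size-⊗<⇒∼[] (u ⊕ neg Q) c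
    (subst (_< size c) (sym (size-cong [u-Q]c∼R)) (proj₁ (proj₂ spec)))))
    where
    open ∼-Reasoning
    spec = quotRem-spec p c sc
    Q = quot p c
    R = rem p c
    [u-Q]c∼R : ((u ⊕ neg Q) ⊗ c) ∼ R
    [u-Q]c∼R = begin
      (u ⊕ neg Q) ⊗ c               ≈⟨ ⊗-distribʳ u (neg Q) c ⟩
      (u ⊗ c) ⊕ (neg Q ⊗ c)         ≈⟨ ⊕-cong (∼-sym p∼uc) (neg-⊗ Q c) ⟩
      p ⊕ neg (Q ⊗ c)               ≈⟨ ⊕-cong (proj₁ spec) ∼-refl ⟩
      ((Q ⊗ c) ⊕ R) ⊕ neg (Q ⊗ c)   ≈⟨ ⊕-neg-cancelˡ (Q ⊗ c) R ⟩
      R                             ∎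

  -- Divisibility and the Euclidean algorithm

  infix 4 _∣_
  record _∣_ (e p : P) : Set where
    constructor divides
    field
      quotient : P
      equality : p ∼ (e ⊗ quotient)

  ∣-respʳ : ∀ {e p p'} → p ∼ p' → e ∣ p → e ∣ p'
  ∣-respʳ p∼p' (divides u p∼eu) = divides u (∼-trans (∼-sym p∼p') p∼eu)

  ∣-respˡ : ∀ {e e' p} → e ∼ e' → e ∣ p → e' ∣ p
  ∣-respˡ e∼e' (divides u p∼eu) = divides u (∼-trans p∼eu (⊗-congˡ u e∼e'))

  ∣-refl : ∀ e → e ∣ e
  ∣-refl e = divides one (∼-sym (⊗-identityʳ e))

  ∣-trans : ∀ {e f p} → e ∣ f → f ∣ p → e ∣ p
  ∣-trans {e} (divides u f∼eu) (divides w p∼fw) =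
    divides (u ⊗ w) (∼-trans p∼fw (∼-trans (⊗-congˡ w f∼eu) (⊗-assoc e u w)))

  ∣-⊕ : ∀ {e x y} → e ∣ x → e ∣ y → e ∣ (x ⊕ y)
  ∣-⊕ {e} (divides u x∼eu) (divides v y∼ev) =
    divides (u ⊕ v) (∼-trans (⊕-cong x∼eu y∼ev) (∼-sym (⊗-distribˡ e u v)))

  ∣-⊗ : ∀ {e x} z → e ∣ x → e ∣ (z ⊗ x)
  ∣-⊗ {e} {x} z (divides u x∼eu) = divides (z ⊗ u) (begin
    z ⊗ x           ≈⟨ ⊗-congʳ z x∼eu ⟩
    z ⊗ (e ⊗ u)     ≈⟨ ⊗-assoc z e u ⟨
    (z ⊗ e) ⊗ u     ≈⟨ ⊗-congˡ u (⊗-comm z e) ⟩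
    (e ⊗ z) ⊗ u     ≈⟨ ⊗-assoc e z u ⟩
    e ⊗ (z ⊗ u)     ∎)
    where open ∼-Reasoning

  ∣-⊗-cong : ∀ G {e b} → e ∣ b → (G ⊗ e) ∣ (G ⊗ b)
  ∣-⊗-cong G {e} (divides u b∼eu) = divides u (∼-trans (⊗-congʳ G b∼eu) (∼-sym (⊗-assoc G e u)))

  ∣-∼[] : ∀ e {p} → p ∼ [] → e ∣ p
  ∣-∼[] e p∼[] = divides [] (∼-trans p∼[] (∼-sym (⊗-zeroʳ e)))

  ∼[]-∣⇒∼[] : ∀ {e p} → e ∼ [] → e ∣ p → p ∼ []
  ∼[]-∣⇒∼[] {e} e∼[] (divides u p∼eu) = ∼-trans p∼eu (⊗-zeroˡ e u e∼[])

  record IsGcd (a b g : P) : Set where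
    field
      ∣ˡ     : g ∣ a
      ∣ʳ     : g ∣ b
      u v    : P
      bezout : g ∼ ((u ⊗ a) ⊕ (v ⊗ b))

  gcdF-spec : ∀ fuel a b → size b < fuel → IsGcd a b (gcdF fuel a b) × NF (gcdF fuel a b)
  gcdF-spec (suc fuel) a b b<fuel with norm b in eqb
  ... | [] = record
    { ∣ˡ = ∣-respˡ (∼-sym (norm∼ a)) (∣-refl a)
    ; ∣ʳ = ∣-∼[] (norm a) (∼-trans (∼-sym (norm∼ b)) (subst (_∼ []) (sym eqb) ∼-refl))
    ; u = one ; v = []
    ; bezout = ∼-trans (norm∼ a) (∼-sym (∼-trans (⊕-identityʳ (one ⊗ a)) (⊗-identityˡ a)))
    } , norm-NF a
  ... | b'@(_ ∷ xs) = record
    { ∣ˡ = ∣-respʳ (∼-sym a∼Qb'+r) (∣-⊕ (∣-⊗ Q (IsGcd.∣ˡ ih)) (IsGcd.∣ʳ ih))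
    ; ∣ʳ = ∣-respʳ b'∼b (IsGcd.∣ˡ ih)
    ; u = v ; v = u ⊕ neg (v ⊗ Q)
    ; bezout = bezout
    } , proj₂ rec
    where
    open ∼-Reasoning
    b'∼b : b' ∼ b
    b'∼b = subst (_∼ b) eqb (norm∼ b)
    size-b' : size b' ≡ suc (length xs)
    size-b' = size-NF (subst NF eqb (norm-NF b))
    Q = quot a b'
    r = rem a b'
    a∼Qb'+r = proj₁ (quotRem-spec a b' size-b')
    r<fuel : size r < fuel
    r<fuel = ℕP.<-≤-trans (proj₁ (proj₂ (quotRem-spec a b' size-b')))
                          (ℕP.≤-pred (subst (_< suc fuel) (sym size-b') b<fuel))
    rec = gcdF-spec fuel b' r r<fuel
    ih = proj₁ rec
    u = IsGcd.u ih
    v = IsGcd.v ih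
    bezout : gcdF fuel b' r ∼ ((v ⊗ a) ⊕ ((u ⊕ neg (v ⊗ Q)) ⊗ b))
    bezout = begin
      gcdF fuel b' r                                  ≈⟨ IsGcd.bezout ih ⟩
      (u ⊗ b') ⊕ (v ⊗ r)                              ≈⟨ ⊕-congˡ (u ⊗ b') (⊗-congʳ v (begin
          r                                  ≈⟨ ⊕-neg-cancelˡ (Q ⊗ b') r ⟨
          ((Q ⊗ b') ⊕ r) ⊕ neg (Q ⊗ b')      ≈⟨ ⊕-cong (∼-sym a∼Qb'+r) ∼-refl ⟩
          a ⊕ neg (Q ⊗ b')                   ∎)) ⟩
      (u ⊗ b') ⊕ (v ⊗ (a ⊕ neg (Q ⊗ b')))             ≈⟨ ⊕-congˡ (u ⊗ b') (⊗-distribˡ v a _) ⟩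
      (u ⊗ b') ⊕ ((v ⊗ a) ⊕ (v ⊗ neg (Q ⊗ b')))       ≈⟨ ⊕-leftcomm (u ⊗ b') (v ⊗ a) _ ⟩
      (v ⊗ a) ⊕ ((u ⊗ b') ⊕ (v ⊗ neg (Q ⊗ b')))       ≈⟨ ⊕-congˡ (v ⊗ a) (⊕-cong (⊗-congʳ u b'∼b) (begin
          v ⊗ neg (Q ⊗ b')                   ≈⟨ ⊗-neg v (Q ⊗ b') ⟩
          neg (v ⊗ (Q ⊗ b'))                 ≈⟨ neg-cong (⊗-assoc v Q b') ⟨
          neg ((v ⊗ Q) ⊗ b')                 ≈⟨ neg-⊗ (v ⊗ Q) b' ⟨
          neg (v ⊗ Q) ⊗ b'                   ≈⟨ ⊗-congʳ (neg (v ⊗ Q)) b'∼b ⟩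
          neg (v ⊗ Q) ⊗ b                    ∎)) ⟩
      (v ⊗ a) ⊕ ((u ⊗ b) ⊕ (neg (v ⊗ Q) ⊗ b))         ≈⟨ ⊕-congˡ (v ⊗ a) (⊗-distribʳ u (neg (v ⊗ Q)) b) ⟨
      (v ⊗ a) ⊕ ((u ⊕ neg (v ⊗ Q)) ⊗ b)               ∎

  record IsMonic (p : P) : Set where
    constructor mkIsMonic
    field
      degree     : ℕ
      normal     : NF p
      size≡      : size p ≡ suc degree
      leading≡1  : coef p degree ≡ 1#
  open IsMonic public

  IsMonic⇒≁[] : ∀ {p} → IsMonic p → ¬ p ∼ []
  IsMonic⇒≁[] m = size≡suc⇒≁[] (size≡ m)

  last≡just⇒NF : ∀ p {x} → last p ≡ just x → x ≢ 0# → NF p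
  last≡just⇒NF (a ∷ [])    e x≢0 = nf1 (λ a≡0 → x≢0 (trans (sym (Maybe.just-injective e)) a≡0))
  last≡just⇒NF (a ∷ b ∷ p) e x≢0 = nf∷ (last≡just⇒NF (b ∷ p) e x≢0)

  Monic⇒IsMonic : ∀ {c} → Monic c → IsMonic c
  Monic⇒IsMonic {a ∷ cs} mc = mkIsMonic (length cs) nc (size-NF nc)
    (Maybe.just-injective (trans (sym (last≡coef (a ∷ cs) refl)) mc))
    where nc = last≡just⇒NF (a ∷ cs) mc (λ 1≡0 → 0≢1 (sym 1≡0))

  IsMonic⇒Monic : ∀ {c} → IsMonic c → Monic c
  IsMonic⇒Monic {c} mc =
    trans (last≡coef c (trans (sym (size-NF (normal mc))) (size≡ mc))) (cong just (leading≡1 mc))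

  IsMonic-one : IsMonic one
  IsMonic-one = Monic⇒IsMonic refl

  size-scale : ∀ {c} p {k} → c ≢ 0# → size p ≡ suc k → size (scale c p) ≡ suc k
  size-scale {c} p {k} c≢0 sp = ℕP.≤-antisym
    (size-≤ (scale c p) (suc k) λ i k<i →
      trans (coef-scale c p i) (trans (cong (c *F_) (size≤⇒VanishesFrom p (ℕP.≤-reflexive sp) i k<i))
                                      (zeroʳ c)))
    (coef≢0⇒<size (scale c p) λ ck≡0 →
      x*y≢0 c≢0 (coef-top≢0 p sp) (trans (sym (coef-scale c p k)) ck≡0))

  monic-spec : ∀ G → (G ∼ [] × monic G ≡ []) ⊎ (IsMonic (monic G) × monic G ∣ G)
  monic-spec G with size G in sG
  ... | zero  = inj₁ (G∼[] , NF-∼⇒≡ (NF-scale _ G) nf[]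
                               (mk∼ λ i → trans (coef-scale _ G i) (trans (cong (_ *F_) (at G∼[] i)) (zeroʳ _))))
    where G∼[] = size≡0⇒∼[] G sG
  ... | suc k =
    inj₂ (mkIsMonic k (NF-scale _ G) (size-scale G (x⁻¹≢0 l≢0) sG) leading , divides (l ∷ []) G∼mG⊗l)
    where
    l = lead G
    l≡ : l ≡ coef G k
    l≡ = lead≡coef G sG
    l≢0 : l ≢ 0#
    l≢0 e = coef-top≢0 G sG (trans (sym l≡) e)
    leading : coef (monic G) k ≡ 1#
    leading = trans (coef-scale (l ⁻¹) G k) (trans (cong (l ⁻¹ *F_) (sym l≡)) (x⁻¹*x≡1 l≢0))
    G∼mG⊗l : G ∼ (monic G ⊗ (l ∷ []))
    G∼mG⊗l = mk∼ λ i → sym (begin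
      coef (monic G ⊗ (l ∷ [])) i     ≡⟨ at (⊗-[c] (monic G) l) i ⟩
      coef (scale l (monic G)) i      ≡⟨ coef-scale l (monic G) i ⟩
      l *F coef (monic G) i           ≡⟨ cong (l *F_) (coef-scale (l ⁻¹) G i) ⟩
      l *F (l ⁻¹ *F coef G i)         ≡⟨ *-assoc _ _ _ ⟨
      l *F l ⁻¹ *F coef G i           ≡⟨ cong (_*F coef G i) (⁻¹-inverse l l≢0) ⟩
      1# *F coef G i                  ≡⟨ *-identityˡ _ ⟩
      coef G i                        ∎)
      where open ≡-Reasoning

  monic-∼⊗ : ∀ G → monic G ∼ ((lead G ⁻¹ ∷ []) ⊗ G)
  monic-∼⊗ G = ∼-sym (∼-trans (⊗-comm _ G) (⊗-[c] G (lead G ⁻¹)))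

  gcd-spec : ∀ a b → IsGcd a b (gcd a b) × (gcd a b ≡ [] ⊎ IsMonic (gcd a b))
  gcd-spec a b with monic-spec G₀ | gcdF-spec (suc (length a + length b)) a b b<fuel
    where
    G₀ = gcdF (suc (length a + length b)) a b
    b<fuel = s≤s (ℕP.≤-trans (size≤length b) (ℕP.m≤n+m _ _))
  ... | inj₁ (G₀∼[] , gcd≡[]) | G₀-gcd , _ = record
    { ∣ˡ = ∣-∼[] _ (∼[]-∣⇒∼[] G₀∼[] (IsGcd.∣ˡ G₀-gcd))
    ; ∣ʳ = ∣-∼[] _ (∼[]-∣⇒∼[] G₀∼[] (IsGcd.∣ʳ G₀-gcd))
    ; u = [] ; v = []
    ; bezout = subst (_∼ _) (sym gcd≡[]) (mk∼ λ i → sym (trans (coef-⊕ [] [] i) (+-identityˡ 0#)))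
    } , inj₁ gcd≡[]
  ... | inj₂ (monic , gcd∣G₀) | G₀-gcd , _ = record
    { ∣ˡ = ∣-trans gcd∣G₀ (IsGcd.∣ˡ G₀-gcd) ; ∣ʳ = ∣-trans gcd∣G₀ (IsGcd.∣ʳ G₀-gcd)
    ; u = l⁻¹ ⊗ u ; v = l⁻¹ ⊗ v
    ; bezout = begin
        gcd a b                              ≈⟨ monic-∼⊗ G₀ ⟩
        l⁻¹ ⊗ G₀                             ≈⟨ ⊗-congʳ l⁻¹ (IsGcd.bezout G₀-gcd) ⟩
        l⁻¹ ⊗ ((u ⊗ a) ⊕ (v ⊗ b))            ≈⟨ ⊗-distribˡ l⁻¹ (u ⊗ a) (v ⊗ b) ⟩
        (l⁻¹ ⊗ (u ⊗ a)) ⊕ (l⁻¹ ⊗ (v ⊗ b))    ≈⟨ ⊕-cong (⊗-assoc l⁻¹ u a) (⊗-assoc l⁻¹ v b) ⟨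
        ((l⁻¹ ⊗ u) ⊗ a) ⊕ ((l⁻¹ ⊗ v) ⊗ b)    ∎
    } , inj₂ monic
    where
    open ∼-Reasoning
    G₀ = gcdF (suc (length a + length b)) a b
    l⁻¹ = lead G₀ ⁻¹ ∷ []
    u = IsGcd.u G₀-gcd
    v = IsGcd.v G₀-gcd

  Combination : List P → P → Set
  Combination []       G = G ∼ []
  Combination (b ∷ bs) G = ∃₂ λ u r → Combination bs r × G ∼ ((u ⊗ b) ⊕ r)

  Combination-⊗ : ∀ bs v {G} → Combination bs G → Combination bs (v ⊗ G)
  Combination-⊗ []       v G∼[]             = ∼-trans (⊗-congʳ v G∼[]) (⊗-zeroʳ v)
  Combination-⊗ (b ∷ bs) v (u , r , cr , G∼) = v ⊗ u , v ⊗ r , Combination-⊗ bs v cr ,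
    ∼-trans (⊗-congʳ v G∼) (∼-trans (⊗-distribˡ v _ r) (⊕-cong (∼-sym (⊗-assoc v u b)) ∼-refl))

  ∣-Combination : ∀ {e} bs {G} → All (e ∣_) bs → Combination bs G → e ∣ G
  ∣-Combination {e} []       []         G∼[]             = ∣-∼[] e G∼[]
  ∣-Combination     (b ∷ bs) (e∣b ∷ e∣bs) (u , r , cr , G∼) =
    ∣-respʳ (∼-sym G∼) (∣-⊕ (∣-⊗ u e∣b) (∣-Combination bs e∣bs cr))

  record IsGcdList (bs : List P) (G : P) : Set where
    field
      divides-all   : All (G ∣_) bs
      combination   : Combination bs G
      zero-or-monic : G ≡ [] ⊎ IsMonic G

  gcdList-spec : ∀ bs → IsGcdList bs (gcdList bs)
  gcdList-spec []       = record { divides-all = [] ; combination = ∼-refl ; zero-or-monic = inj₁ refl }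
  gcdList-spec (b ∷ bs) = record
    { divides-all   = IsGcd.∣ˡ g ∷ All.map (∣-trans (IsGcd.∣ʳ g)) (IsGcdList.divides-all rest)
    ; combination   = IsGcd.u g , IsGcd.v g ⊗ gcdList bs
                    , Combination-⊗ bs (IsGcd.v g) (IsGcdList.combination rest) , IsGcd.bezout g
    ; zero-or-monic = proj₂ (gcd-spec b (gcdList bs))
    }
    where
    g = proj₁ (gcd-spec b (gcdList bs))
    rest = gcdList-spec bs

  monic-cofactor : ∀ {G b q} (mG : IsMonic G) (mb : IsMonic b) → b ∼ (G ⊗ q) →
    ∃ λ dq → size q ≡ suc dq × coef q dq ≡ 1# × degree mG + dq ≡ degree mb
  monic-cofactor {G} {b} {q} mG mb b∼Gq = dq , sq , leading , degrees
    where
    open ≡-Reasoning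
    q≁[] : ¬ q ∼ []
    q≁[] q∼[] = IsMonic⇒≁[] mb (∼-trans b∼Gq (∼-trans (⊗-comm G q) (⊗-zeroˡ q G q∼[])))
    dq = proj₁ (≁[]⇒size≡suc q q≁[])
    sq = proj₂ (≁[]⇒size≡suc q q≁[])
    degrees : degree mG + dq ≡ degree mb
    degrees = ℕP.suc-injective
      (trans (sym (size-⊗ G q (size≡ mG) sq)) (trans (sym (size-cong b∼Gq)) (size≡ mb)))
    leading : coef q dq ≡ 1#
    leading = begin
      coef q dq                         ≡⟨ sym (*-identityˡ _) ⟩
      1# *F coef q dq                   ≡⟨ cong (_*F coef q dq) (sym (leading≡1 mG)) ⟩
      coef G (degree mG) *F coef q dq   ≡⟨ sym (coef-⊗-leading G q (size≡ mG) sq) ⟩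
      coef (G ⊗ q) (degree mG + dq)     ≡⟨ sym (at b∼Gq _) ⟩
      coef b (degree mG + dq)           ≡⟨ cong (coef b) degrees ⟩
      coef b (degree mb)                ≡⟨ leading≡1 mb ⟩
      1#                                ∎

  IsMonic-∣-antisym : ∀ {G₁ G₂} → IsMonic G₁ → IsMonic G₂ → G₁ ∣ G₂ → G₂ ∣ G₁ → G₁ ≡ G₂
  IsMonic-∣-antisym {G₁} {G₂} m₁ m₂ (divides u G₂∼G₁u) (divides w G₁∼G₂w)
    with monic-cofactor m₁ m₂ G₂∼G₁u | monic-cofactor m₂ m₁ G₁∼G₂w
  ... | du , su , lu , k₁+du≡k₂ | dw , _ , _ , k₂+dw≡k₁ =
    NF-∼⇒≡ (normal m₁) (normal m₂)
      (∼-sym (∼-trans G₂∼G₁u (∼-trans (⊗-congʳ G₁ u∼one) (⊗-identityʳ G₁))))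
    where
    open ≡-Reasoning
    k₁ = degree m₁
    du≡0 : du ≡ 0
    du≡0 = ℕP.m+n≡0⇒m≡0 du (ℕP.+-cancelˡ-≡ k₁ _ _ (begin
      k₁ + (du + dw)     ≡⟨ sym (ℕP.+-assoc k₁ du dw) ⟩
      k₁ + du + dw       ≡⟨ cong (_+ dw) k₁+du≡k₂ ⟩
      degree m₂ + dw     ≡⟨ k₂+dw≡k₁ ⟩
      k₁                 ≡⟨ sym (ℕP.+-identityʳ k₁) ⟩
      k₁ + 0             ∎))
    u∼one : u ∼ one
    u∼one = mk∼ λ where
      zero    → subst (λ i → coef u i ≡ 1#) du≡0 lu
      (suc i) → coef-≥size u (subst (_≤ suc i) (sym (trans su (cong suc du≡0))) (s≤s z≤n))

  gcdList-unique : ∀ bs {H} → IsMonic H → All (H ∣_) bs → Combination bs H → gcdList bs ≡ H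
  gcdList-unique bs mH H∣bs cH with IsGcdList.zero-or-monic (gcdList-spec bs)
  ... | inj₁ G≡[] = ⊥-elim (IsMonic⇒≁[] mH (∼[]-∣⇒∼[] (subst (_∼ []) (sym G≡[]) ∼-refl) G∣H))
    where G∣H = ∣-Combination bs (IsGcdList.divides-all (gcdList-spec bs)) cH
  ... | inj₂ mG = IsMonic-∣-antisym mG mH
    (∣-Combination bs (IsGcdList.divides-all (gcdList-spec bs)) cH)
    (∣-Combination bs H∣bs (IsGcdList.combination (gcdList-spec bs)))

  IsMonic-⊗ : ∀ {G H} (mG : IsMonic G) (mH : IsMonic H) → IsMonic (G ⊗ H)
  IsMonic-⊗ {G} {H} mG mH =
    mkIsMonic (degree mG + degree mH) (NF-⊗ G H) (size-⊗ G H (size≡ mG) (size≡ mH))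
      (trans (coef-⊗-leading G H (size≡ mG) (size≡ mH))
             (trans (cong₂ _*F_ (leading≡1 mG) (leading≡1 mH)) (*-identityˡ 1#)))

  size-⊗-≤ : ∀ p r {dp} → size p ≡ suc dp → size (p ⊗ r) ≤ dp + size r
  size-⊗-≤ p r {dp} sp with size r in sr
  ... | zero   =
    subst (_≤ dp + 0) (sym (∼[]⇒size≡0 (∼-trans (⊗-congʳ p (size≡0⇒∼[] r sr)) (⊗-zeroʳ p)))) z≤n
  ... | suc dr = ℕP.≤-reflexive (trans (size-⊗ p r sp sr) (sym (ℕP.+-suc dp dr)))

  NF-quot : ∀ b {G} → IsMonic G → NF (quot b G)
  NF-quot b {G} mG = proj₂ (proj₂ (quotRem-spec b G (size≡ mG)))

  ∣⇒∼⊗quot : ∀ {b G} → IsMonic G → G ∣ b → b ∼ (G ⊗ quot b G)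
  ∣⇒∼⊗quot {b} {G} mG (divides u b∼Gu) =
    ∼-trans b∼Gu (⊗-congʳ G (∼-sym (quot-exact b G u (size≡ mG) (∼-trans b∼Gu (⊗-comm G u)))))

  quot-⊗ : ∀ {G} b → IsMonic G → NF b → quot (G ⊗ b) G ≡ b
  quot-⊗ {G} b mG nb = NF-∼⇒≡ (NF-quot (G ⊗ b) mG) nb (quot-exact (G ⊗ b) G b (size≡ mG) (⊗-comm G b))

  ⊗-quot : ∀ {G b} → IsMonic G → NF b → G ∣ b → G ⊗ quot b G ≡ b
  ⊗-quot {G} {b} mG nb G∣b = NF-∼⇒≡ (NF-⊗ G (quot b G)) nb (∼-sym (∣⇒∼⊗quot mG G∣b))

  -- Stated with norm b ≡ b rather than NF b, so that these predicates are proof-irrelevant.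
  MonicOfDegree : ℕ → P → Set
  MonicOfDegree n b = (norm b ≡ b) × (length b ≡ suc n) × (coef b n ≡ 1#)

  DegreeBelow : ℕ → P → Set
  DegreeBelow n b = (norm b ≡ b) × (length b ≤ n)

  MonicOfDegree⇒IsMonic : ∀ {n b} → MonicOfDegree n b → IsMonic b
  MonicOfDegree⇒IsMonic {n} {b} (nb , lb , top) =
    mkIsMonic n (subst NF nb (norm-NF b)) (trans (cong length nb) lb) top

  ⊗-MonicOfDegree : ∀ {G m b} (mG : IsMonic G) → MonicOfDegree m b → MonicOfDegree (m + degree mG) (G ⊗ b)
  ⊗-MonicOfDegree {G} {m} {b} mG mb = NF⇒norm≡ (normal mGb) ,
    trans (sym (size-NF (normal mGb))) (trans (size≡ mGb) (cong suc (ℕP.+-comm (degree mG) m))) ,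
    subst (λ i → coef (G ⊗ b) i ≡ 1#) (ℕP.+-comm (degree mG) m) (leading≡1 mGb)
    where mGb = IsMonic-⊗ mG (MonicOfDegree⇒IsMonic mb)

  ⊗-DegreeBelow : ∀ {G m b} (mG : IsMonic G) → DegreeBelow m b → DegreeBelow (m + degree mG) (G ⊗ b)
  ⊗-DegreeBelow {G} {m} {b} mG (nb , lb) = NF⇒norm≡ (NF-⊗ G b) , (begin
    length (G ⊗ b)      ≡⟨ size-NF (NF-⊗ G b) ⟨
    size (G ⊗ b)        ≤⟨ size-⊗-≤ G b (size≡ mG) ⟩
    degree mG + size b  ≡⟨ cong (degree mG +_) (cong length nb) ⟩
    degree mG + length b ≤⟨ ℕP.+-monoʳ-≤ (degree mG) lb ⟩
    degree mG + m       ≡⟨ ℕP.+-comm (degree mG) m ⟩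
    m + degree mG       ∎)
    where open ℕP.≤-Reasoning

  quot-MonicOfDegree : ∀ {G n b} (mG : IsMonic G) → MonicOfDegree n b → G ∣ b →
                       degree mG ≤ n × MonicOfDegree (n ∸ degree mG) (quot b G)
  quot-MonicOfDegree {G} {n} {b} mG mb G∣b =
    from-cofactor (monic-cofactor mG (MonicOfDegree⇒IsMonic mb) (∣⇒∼⊗quot mG G∣b))
    where
    Q = quot b G
    nq = NF-quot b mG
    from-cofactor : (∃ λ dq → size Q ≡ suc dq × coef Q dq ≡ 1# × degree mG + dq ≡ n) →
                    degree mG ≤ n × MonicOfDegree (n ∸ degree mG) Q
    from-cofactor (dq , sq , top , k+dq≡n) =
      subst (degree mG ≤_) k+dq≡n (ℕP.m≤m+n _ dq) ,
      NF⇒norm≡ nq , trans (sym (size-NF nq)) (trans sq (cong suc dq≡)) ,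
      subst (λ i → coef Q i ≡ 1#) dq≡ top
      where
      dq≡ : dq ≡ n ∸ degree mG
      dq≡ = trans (sym (ℕP.m+n∸m≡n (degree mG) dq)) (cong (_∸ degree mG) k+dq≡n)

  quot-DegreeBelow : ∀ {G n b} (mG : IsMonic G) → DegreeBelow n b → G ∣ b →
                     DegreeBelow (n ∸ degree mG) (quot b G)
  quot-DegreeBelow {G} {n} {b} mG (nb , lb) G∣b =
    NF⇒norm≡ nq , subst (_≤ n ∸ degree mG) (size-NF nq) size-q≤
    where
    nq = NF-quot b mG
    size-q≤ : size (quot b G) ≤ n ∸ degree mG
    size-q≤ with size (quot b G) in sq
    ... | zero   = z≤n
    ... | suc dq = ℕP.m+n≤o⇒m≤o∸n (suc dq) (begin
      suc dq + degree mG     ≡⟨ ℕP.+-comm (suc dq) (degree mG) ⟩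
      degree mG + suc dq     ≡⟨ ℕP.+-suc (degree mG) dq ⟩
      suc (degree mG + dq)   ≡⟨ size-⊗ G (quot b G) (size≡ mG) sq ⟨
      size (G ⊗ quot b G)    ≡⟨ size-cong (∣⇒∼⊗quot mG G∣b) ⟨
      size b                 ≡⟨ cong length nb ⟩
      length b               ≤⟨ lb ⟩
      n                      ∎)
      where open ℕP.≤-Reasoning

  Combination-map-⊗ : ∀ bs G {H} → Combination bs H → Combination (map (G ⊗_) bs) (G ⊗ H)
  Combination-map-⊗ []       G H∼[]             = ∼-trans (⊗-congʳ G H∼[]) (⊗-zeroʳ G)
  Combination-map-⊗ (b ∷ bs) G {H} (u , r , cr , H∼) = u , G ⊗ r , Combination-map-⊗ bs G cr , (begin
    G ⊗ H                          ≈⟨ ⊗-congʳ G H∼ ⟩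
    G ⊗ ((u ⊗ b) ⊕ r)              ≈⟨ ⊗-distribˡ G (u ⊗ b) r ⟩
    (G ⊗ (u ⊗ b)) ⊕ (G ⊗ r)        ≈⟨ ⊕-cong G[ub]∼u[Gb] ∼-refl ⟩
    (u ⊗ (G ⊗ b)) ⊕ (G ⊗ r)        ∎)
    where
    open ∼-Reasoning
    G[ub]∼u[Gb] : (G ⊗ (u ⊗ b)) ∼ (u ⊗ (G ⊗ b))
    G[ub]∼u[Gb] = begin
      G ⊗ (u ⊗ b)    ≈⟨ ⊗-assoc G u b ⟨
      (G ⊗ u) ⊗ b    ≈⟨ ⊗-congˡ b (⊗-comm G u) ⟩
      (u ⊗ G) ⊗ b    ≈⟨ ⊗-assoc u G b ⟩
      u ⊗ (G ⊗ b)    ∎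

  gcdList-map-⊗ : ∀ bs {G} → IsMonic G → IsMonic (gcdList bs) → gcdList (map (G ⊗_) bs) ≡ G ⊗ gcdList bs
  gcdList-map-⊗ bs {G} mG mH = gcdList-unique (map (G ⊗_) bs) (IsMonic-⊗ mG mH)
    (Allₚ.map⁺ (All.map (∣-⊗-cong G) (IsGcdList.divides-all spec)))
    (Combination-map-⊗ bs G (IsGcdList.combination spec))
    where
    spec = gcdList-spec bs


module ContentDecomposition (𝔽 : FiniteField) (d : ℕ) where
  open FiniteField 𝔽 renaming (_+_ to infixl 6 _+F_; _*_ to infixl 7 _*F_; -_ to -F_)
  open Poly 𝔽
  open PolynomialArithmetic 𝔽

  -- The x-coefficients b₀, …, b_d ∈ F[y] of a polynomial in F[x][y] of x-degree ≤ d
  -- that is monic of y-degree n.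
  Admissible : ℕ → List P → Set
  Admissible n []       = ⊥
  Admissible n (b ∷ bs) = MonicOfDegree n b × All (DegreeBelow n) bs × length bs ≡ d

  Tuples : ℕ → Set
  Tuples n = Σ (List P) (Admissible n)

  WithContent : ℕ → P → Set
  WithContent n c = Σ (Tuples n) (λ t → gcdList (proj₁ t) ≡ c)

  Primitive : ℕ → Set
  Primitive n = WithContent n one

  ≡-irrelevantₚ : Irrelevant (_≡_ {A = P})
  ≡-irrelevantₚ = Decidable⇒UIP.≡-irrelevant (List.≡-dec _≟_)

  Admissible-irrelevant : ∀ {n} bs → Nullary.Irrelevant (Admissible n bs)
  Admissible-irrelevant (b ∷ bs) = ×-irrelevant
    (×-irrelevant ≡-irrelevantₚ (×-irrelevant ℕP.≡-irrelevant (Decidable⇒UIP.≡-irrelevant _≟_)))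
    (×-irrelevant (All.irrelevant (×-irrelevant ≡-irrelevantₚ ℕP.≤-irrelevant)) ℕP.≡-irrelevant)

  Tuples-≡ : ∀ {n} {t t' : Tuples n} → proj₁ t ≡ proj₁ t' → t ≡ t'
  Tuples-≡ {t = bs , adm} refl = cong (bs ,_) (Admissible-irrelevant bs adm _)

  WithContent-≡ : ∀ {n c} {t t' : WithContent n c} → proj₁ (proj₁ t) ≡ proj₁ (proj₁ t') → t ≡ t'
  WithContent-≡ {t = t , e} {t' , e'} bs≡bs' with Tuples-≡ {t = t} {t'} bs≡bs'
  ... | refl = cong (t ,_) (≡-irrelevantₚ e e')

  quotAll : P → List P → List P
  quotAll G = map (λ b → quot b G)

  Admissible⇒All-NF : ∀ {n} bs → Admissible n bs → All NF bs
  Admissible⇒All-NF (b ∷ bs) (mb , dbs , _) =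
    normal (MonicOfDegree⇒IsMonic mb) ∷ All.map (λ {b} (nb , _) → subst NF nb (norm-NF b)) dbs

  map-⊗-Admissible : ∀ {G m} bs (mG : IsMonic G) → Admissible m bs →
                     Admissible (m + degree mG) (map (G ⊗_) bs)
  map-⊗-Admissible (b ∷ bs) mG (mb , dbs , len) =
    ⊗-MonicOfDegree mG mb , Allₚ.map⁺ (All.map (⊗-DegreeBelow mG) dbs) , trans (List.length-map _ bs) len

  quotAll-Admissible : ∀ {G n} bs (mG : IsMonic G) → Admissible n bs → All (G ∣_) bs →
                       degree mG ≤ n × Admissible (n ∸ degree mG) (quotAll G bs)
  quotAll-Admissible (b ∷ bs) mG (mb , dbs , len) (G∣b ∷ G∣bs) =
    proj₁ (quot-MonicOfDegree mG mb G∣b) , proj₂ (quot-MonicOfDegree mG mb G∣b) ,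
    Allₚ.map⁺ (All.zipWith (λ (db , G∣) → quot-DegreeBelow mG db G∣) (dbs , G∣bs)) ,
    trans (List.length-map _ bs) len

  map-⊗-quotAll : ∀ {G n} bs → IsMonic G → Admissible n bs → All (G ∣_) bs →
                  map (G ⊗_) (quotAll G bs) ≡ bs
  map-⊗-quotAll bs mG adm G∣bs = trans (sym (List.map-∘ bs))
    (List.map-id-local (All.zipWith (λ (nb , G∣b) → ⊗-quot mG nb G∣b) (Admissible⇒All-NF bs adm , G∣bs)))

  quotAll-map-⊗ : ∀ {G n} bs → IsMonic G → Admissible n bs → quotAll G (map (G ⊗_) bs) ≡ bs
  quotAll-map-⊗ bs mG adm = trans (sym (List.map-∘ bs))
    (List.map-id-local (All.map (λ {b} nb → quot-⊗ b mG nb) (Admissible⇒All-NF bs adm)))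

  Admissible⇒IsMonic-gcdList : ∀ {n} bs → Admissible n bs → IsMonic (gcdList bs)
  Admissible⇒IsMonic-gcdList (b ∷ bs) (mb , _) with IsGcdList.zero-or-monic (gcdList-spec (b ∷ bs))
  ... | inj₂ mG   = mG
  ... | inj₁ G≡[] = ⊥-elim (IsMonic⇒≁[] (MonicOfDegree⇒IsMonic mb)
    (∼[]-∣⇒∼[] (subst (_∼ []) (sym G≡[]) ∼-refl) (All.head (IsGcdList.divides-all (gcdList-spec (b ∷ bs))))))

  gcdList-map-⊗-one : ∀ bs {G} → IsMonic G → gcdList bs ≡ one → gcdList (map (G ⊗_) bs) ≡ G
  gcdList-map-⊗-one bs {G} mG content≡one = begin
    gcdList (map (G ⊗_) bs)   ≡⟨ gcdList-map-⊗ bs mG (subst IsMonic (sym content≡one) IsMonic-one) ⟩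
    G ⊗ gcdList bs            ≡⟨ cong (G ⊗_) content≡one ⟩
    G ⊗ one                   ≡⟨ NF-∼⇒≡ (NF-⊗ G one) (normal mG) (⊗-identityʳ G) ⟩
    G                         ∎
    where open ≡-Reasoning

  gcdList-quotAll : ∀ {G n} bs (mG : IsMonic G) → Admissible n bs → gcdList bs ≡ G →
                    gcdList (quotAll G bs) ≡ one
  gcdList-quotAll {G} bs mG adm content≡G = NF-∼⇒≡ (normal mH) (normal IsMonic-one)
    (⊗-cancelˡ G (IsMonic⇒≁[] mG) (mk∼ λ i → cong (λ p → coef p i) GH≡G⊗one))
    where
    open ≡-Reasoning
    G∣bs = subst (λ G → All (G ∣_) bs) content≡G (IsGcdList.divides-all (gcdList-spec bs))
    bs' = quotAll G bs
    mH = Admissible⇒IsMonic-gcdList bs' (proj₂ (quotAll-Admissible bs mG adm G∣bs))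
    GH≡G⊗one : G ⊗ gcdList bs' ≡ G ⊗ one
    GH≡G⊗one = begin
      G ⊗ gcdList bs'             ≡⟨ gcdList-map-⊗ bs' mG mH ⟨
      gcdList (map (G ⊗_) bs')    ≡⟨ cong gcdList (map-⊗-quotAll bs mG adm G∣bs) ⟩
      gcdList bs                  ≡⟨ content≡G ⟩
      G                           ≡⟨ NF-∼⇒≡ (NF-⊗ G one) (normal mG) (⊗-identityʳ G) ⟨
      G ⊗ one                     ∎

  WithContent↔Primitive : ∀ {c n} (mC : IsMonic c) → degree mC ≤ n →
                          WithContent n c ↔ Primitive (n ∸ degree mC)
  WithContent↔Primitive {c} {n} mC k≤n = mk↔ₛ′ divide multiply
    (λ ((bs , adm) , _) → WithContent-≡ (quotAll-map-⊗ bs mC adm))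
    (λ ((bs , adm) , e) → WithContent-≡ (map-⊗-quotAll bs mC adm (c∣bs bs e)))
    where
    c∣bs : ∀ bs → gcdList bs ≡ c → All (c ∣_) bs
    c∣bs bs e = subst (λ G → All (G ∣_) bs) e (IsGcdList.divides-all (gcdList-spec bs))
    divide : WithContent n c → Primitive (n ∸ degree mC)
    divide ((bs , adm) , e) =
      (quotAll c bs , proj₂ (quotAll-Admissible bs mC adm (c∣bs bs e))) , gcdList-quotAll bs mC adm e
    multiply : Primitive (n ∸ degree mC) → WithContent n c
    multiply ((bs , adm) , e) =
      (map (c ⊗_) bs ,
       subst (λ m → Admissible m (map (c ⊗_) bs)) (ℕP.m∸n+n≡m k≤n) (map-⊗-Admissible bs mC adm)) ,
      gcdList-map-⊗-one bs mC e

  Contents : ℕ → Set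
  Contents n = Σ P (λ c → Monic c × length c ≤ suc n)

  ContentSplit : ℕ → Set
  ContentSplit n = Σ (Contents n) (λ c → Primitive (n ∸ (length (proj₁ c) ∸ 1)))

  content : ∀ {n} → Tuples n → Contents n
  content (bs , adm) = gcdList bs , IsMonic⇒Monic mG ,
    subst (_≤ suc _) (trans (sym (size≡ mG)) (size-NF (normal mG)))
      (s≤s (proj₁ (quotAll-Admissible bs mG adm (IsGcdList.divides-all (gcdList-spec bs)))))
    where mG = Admissible⇒IsMonic-gcdList bs adm

  Tuples↔ContentSplit : ∀ {n} → Tuples n ↔ ContentSplit n
  Tuples↔ContentSplit {n} = ↔-trans fibration (Σ-↔ ↔-refl (λ {c} → fibre {c}))
    where
    fibration : Tuples n ↔ Σ (Contents n) (λ c → WithContent n (proj₁ c))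
    fibration = mk↔ₛ′ (λ t → content t , t , refl) (proj₁ ∘ proj₂)
      (λ { ((c , mc , len) , t , refl) → cong (λ p → ((c , p) , t , refl))
             (×-irrelevant (Decidable⇒UIP.≡-irrelevant (Maybe.≡-dec _≟_)) ℕP.≤-irrelevant _ _) })
      (λ _ → refl)
    fibre : ∀ {c : Contents n} → WithContent n (proj₁ c) ↔ Primitive (n ∸ (length (proj₁ c) ∸ 1))
    fibre {a ∷ cs , mc , len} = WithContent↔Primitive (Monic⇒IsMonic mc) (ℕP.≤-pred len)

  -- A monic polynomial of degree at most m + 1 is either 1 or g₀ + y H with H monic of
  -- degree at most m; the height of the primitive part is unchanged by passing to H.
  ContentSplit-suc↔ : ∀ {m} → ContentSplit (suc m) ↔ (Primitive (suc m) ⊎ (F × ContentSplit m))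
  ContentSplit-suc↔ {m} = mk↔ₛ′ split join split∘join join∘split
    where
    split : ContentSplit (suc m) → Primitive (suc m) ⊎ (F × ContentSplit m)
    split ((a ∷ []     , _  , _)       , p) = inj₁ p
    split ((a ∷ h ∷ hs , mc , s≤s len) , p) = inj₂ (a , (h ∷ hs , mc , len) , p)
    join : Primitive (suc m) ⊎ (F × ContentSplit m) → ContentSplit (suc m)
    join (inj₁ p)                            = (one , refl , s≤s z≤n) , p
    join (inj₂ (a , (h ∷ hs , mc , len) , p)) = (a ∷ h ∷ hs , mc , s≤s len) , p
    split∘join : ∀ x → split (join x) ≡ x
    split∘join (inj₁ p)                            = refl
    split∘join (inj₂ (a , (h ∷ hs , mc , len) , p)) = refl
    join∘split : ∀ x → join (split x) ≡ x
    join∘split ((a ∷ []     , refl , s≤s z≤n) , p) = refl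
    join∘split ((a ∷ h ∷ hs , mc   , s≤s len) , p) = refl

  Tuples-suc↔ : ∀ {m} → Tuples (suc m) ↔ (Primitive (suc m) ⊎ (F × Tuples m))
  Tuples-suc↔ = ↔-trans Tuples↔ContentSplit
    (↔-trans ContentSplit-suc↔ (↔-refl ⊎-↔ (↔-refl ×-↔ ↔-sym Tuples↔ContentSplit)))

  -- Tuples as coefficient vectors

  Coefficients : ℕ → Set
  Coefficients n = Vec (Vec F (suc d)) n

  column : ∀ {n} → Coefficients n → Fin (suc d) → List F
  column a j = Vec.toList (Vec.map (λ aᵢ → Vec.lookup aᵢ j) a)

  -- the coefficient of x^j in the term y^n
  δ₀ : Fin (suc d) → F
  δ₀ fzero    = 1#
  δ₀ (fsuc _) = 0#

  xCoeff : ∀ {n} → Coefficients n → Fin (suc d) → P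
  xCoeff a j = norm (column a j ++ (δ₀ j ∷ []))

  xCoeffs≡tabulate : ∀ {n} (a : Coefficients n) → xCoeffs a ≡ Vec.toList (Vec.tabulate (xCoeff a))
  xCoeffs≡tabulate a = cong (xCoeff a fzero ∷_) (cong Vec.toList (Vecₚ.tabulate-cong (λ _ → refl)))

  nth : List P → ℕ → P
  nth []       _       = []
  nth (b ∷ bs) zero    = b
  nth (b ∷ bs) (suc j) = nth bs j

  nth-tabulate : ∀ {m} (f : Fin m → P) j → nth (Vec.toList (Vec.tabulate f)) (Fin.toℕ j) ≡ f j
  nth-tabulate f fzero    = refl
  nth-tabulate f (fsuc j) = nth-tabulate (f ∘ fsuc) j

  tabulate-nth : ∀ bs {m} → length bs ≡ m →
                 Vec.toList (Vec.tabulate {n = m} (λ j → nth bs (Fin.toℕ j))) ≡ bs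
  tabulate-nth []       {zero}  _ = refl
  tabulate-nth (b ∷ bs) {suc m} e = cong (b ∷_) (tabulate-nth bs (ℕP.suc-injective e))

  NF-∷ʳ : ∀ l {x} → x ≢ 0# → NF (l ++ x ∷ [])
  NF-∷ʳ []          x≢0 = nf1 x≢0
  NF-∷ʳ (y ∷ [])    x≢0 = nf∷ (nf1 x≢0)
  NF-∷ʳ (y ∷ z ∷ l) x≢0 = nf∷ (NF-∷ʳ (z ∷ l) x≢0)

  coef-++ˡ : ∀ l r {i} → i < length l → coef (l ++ r) i ≡ coef l i
  coef-++ˡ (x ∷ l) r {zero}  _         = refl
  coef-++ˡ (x ∷ l) r {suc i} (s≤s i<l) = coef-++ˡ l r i<l

  coef-++ʳ : ∀ l r {i} → length l ≤ i → coef (l ++ r) i ≡ coef r (i ∸ length l)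
  coef-++ʳ []      r         _         = refl
  coef-++ʳ (x ∷ l) r {suc i} (s≤s l≤i) = coef-++ʳ l r l≤i

  coef-toList : ∀ {m} (v : Vec F m) (k : Fin m) → coef (Vec.toList v) (Fin.toℕ k) ≡ Vec.lookup v k
  coef-toList (x Vec.∷ v) fzero    = refl
  coef-toList (x Vec.∷ v) (fsuc k) = coef-toList v k

  length-column : ∀ {n} (a : Coefficients n) j → length (column a j) ≡ n
  length-column a j = Vecₚ.length-toList (Vec.map (λ aᵢ → Vec.lookup aᵢ j) a)

  coef-xCoeff-< : ∀ {n} (a : Coefficients n) j (i : Fin n) →
                  coef (xCoeff a j) (Fin.toℕ i) ≡ Vec.lookup (Vec.lookup a i) j
  coef-xCoeff-< a j i = begin
    coef (xCoeff a j) (Fin.toℕ i)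
      ≡⟨ coef-norm (column a j ++ (δ₀ j ∷ [])) (Fin.toℕ i) ⟩
    coef (column a j ++ (δ₀ j ∷ [])) (Fin.toℕ i)
      ≡⟨ coef-++ˡ (column a j) _ (subst (Fin.toℕ i <_) (sym (length-column a j)) (Finₚ.toℕ<n i)) ⟩
    coef (column a j) (Fin.toℕ i)
      ≡⟨ coef-toList (Vec.map (λ aᵢ → Vec.lookup aᵢ j) a) i ⟩
    Vec.lookup (Vec.map (λ aᵢ → Vec.lookup aᵢ j) a) i
      ≡⟨ Vecₚ.lookup-map i (λ aᵢ → Vec.lookup aᵢ j) a ⟩
    Vec.lookup (Vec.lookup a i) j ∎
    where open ≡-Reasoning

  coef-xCoeff-≥ : ∀ {n} (a : Coefficients n) j {i} → n ≤ i →
                  coef (xCoeff a j) i ≡ coef (δ₀ j ∷ []) (i ∸ n)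
  coef-xCoeff-≥ {n} a j {i} n≤i = begin
    coef (xCoeff a j) i
      ≡⟨ coef-norm (column a j ++ (δ₀ j ∷ [])) i ⟩
    coef (column a j ++ (δ₀ j ∷ [])) i
      ≡⟨ coef-++ʳ (column a j) _ (subst (_≤ i) (sym (length-column a j)) n≤i) ⟩
    coef (δ₀ j ∷ []) (i ∸ length (column a j))
      ≡⟨ cong (λ l → coef (δ₀ j ∷ []) (i ∸ l)) (length-column a j) ⟩
    coef (δ₀ j ∷ []) (i ∸ n) ∎
    where open ≡-Reasoning

  xCoeffs-Admissible : ∀ {n} (a : Coefficients n) → Admissible n (xCoeffs a)
  xCoeffs-Admissible {n} a = subst (Admissible n) (sym (xCoeffs≡tabulate a))
    (head , All-tabulate (xCoeff a ∘ fsuc) tail , Vecₚ.length-toList (Vec.tabulate (xCoeff a ∘ fsuc)))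
    where
    head : MonicOfDegree n (xCoeff a fzero)
    head = NF⇒norm≡ (norm-NF (column a fzero ++ (1# ∷ []))) ,
      trans (cong length (NF⇒norm≡ (NF-∷ʳ (column a fzero) (λ 1≡0 → 0≢1 (sym 1≡0)))))
        (trans (List.length-++ (column a fzero)) (trans (ℕP.+-comm _ 1) (cong suc (length-column a fzero)))) ,
      trans (coef-xCoeff-≥ a fzero ℕP.≤-refl) (cong (coef (1# ∷ [])) (ℕP.n∸n≡0 n))
    tail : ∀ j → DegreeBelow n (xCoeff a (fsuc j))
    tail j = NF⇒norm≡ (norm-NF (column a (fsuc j) ++ (0# ∷ []))) ,
      size-≤ (column a (fsuc j) ++ (0# ∷ [])) n λ i n≤i →
        trans (sym (coef-norm (column a (fsuc j) ++ (0# ∷ [])) i))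
              (trans (coef-xCoeff-≥ a (fsuc j) n≤i) (coef-0∷[] (i ∸ n)))
    All-tabulate : ∀ {m} (f : Fin m → P) → (∀ j → DegreeBelow n (f j)) →
                   All (DegreeBelow n) (Vec.toList (Vec.tabulate f))
    All-tabulate {zero}  f _  = []
    All-tabulate {suc m} f df = df fzero ∷ All-tabulate (f ∘ fsuc) (df ∘ fsuc)

  fromXCoeffs : ∀ {n} → List P → Coefficients n
  fromXCoeffs bs = Vec.tabulate (λ i → Vec.tabulate (λ j → coef (nth bs (Fin.toℕ j)) (Fin.toℕ i)))

  fromXCoeffs-xCoeffs : ∀ {n} (a : Coefficients n) → fromXCoeffs (xCoeffs a) ≡ a
  fromXCoeffs-xCoeffs a = trans
    (Vecₚ.tabulate-cong λ i → trans (Vecₚ.tabulate-cong (entry i)) (Vecₚ.tabulate∘lookup (Vec.lookup a i)))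
    (Vecₚ.tabulate∘lookup a)
    where
    open ≡-Reasoning
    entry : ∀ i j → coef (nth (xCoeffs a) (Fin.toℕ j)) (Fin.toℕ i) ≡ Vec.lookup (Vec.lookup a i) j
    entry i j = begin
      coef (nth (xCoeffs a) (Fin.toℕ j)) (Fin.toℕ i)
        ≡⟨ cong (λ bs → coef (nth bs (Fin.toℕ j)) (Fin.toℕ i)) (xCoeffs≡tabulate a) ⟩
      coef (nth (Vec.toList (Vec.tabulate (xCoeff a))) (Fin.toℕ j)) (Fin.toℕ i)
        ≡⟨ cong (λ b → coef b (Fin.toℕ i)) (nth-tabulate (xCoeff a) j) ⟩
      coef (xCoeff a j) (Fin.toℕ i)
        ≡⟨ coef-xCoeff-< a j i ⟩
      Vec.lookup (Vec.lookup a i) j ∎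

  All-nth : ∀ {Q : P → Set} bs {k} → All Q bs → k < length bs → Q (nth bs k)
  All-nth (b ∷ bs) {zero}  (qb ∷ _)  _         = qb
  All-nth (b ∷ bs) {suc k} (_ ∷ qbs) (s≤s k<l) = All-nth bs qbs k<l

  module _ {n : ℕ} where

    NF-nth : ∀ bs → Admissible n bs → ∀ (j : Fin (suc d)) → NF (nth bs (Fin.toℕ j))
    NF-nth (b ∷ bs) adm j = All-nth (b ∷ bs) (Admissible⇒All-NF (b ∷ bs) adm)
      (subst (Fin.toℕ j <_) (cong suc (sym (proj₂ (proj₂ adm)))) (Finₚ.toℕ<n j))

    coef-nth-≥ : ∀ bs → Admissible n bs → ∀ (j : Fin (suc d)) {i} → n ≤ i →
                 coef (nth bs (Fin.toℕ j)) i ≡ coef (δ₀ j ∷ []) (i ∸ n)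
    coef-nth-≥ (b ∷ bs) ((nb , lb , top) , _) fzero {i} n≤i with i ∸ n in eq
    ... | zero  = trans (cong (coef b) (ℕP.≤-antisym (ℕP.m∸n≡0⇒m≤n eq) n≤i)) top
    ... | suc _ = coef-≥length b
      (subst (_≤ i) (sym lb) (ℕP.m∸n≢0⇒n<m λ i∸n≡0 → case trans (sym eq) i∸n≡0 of λ ()))
    coef-nth-≥ (b ∷ bs) (_ , dbs , lbs) (fsuc j) {i} n≤i =
      trans (coef-≥length (nth bs (Fin.toℕ j)) (ℕP.≤-trans (proj₂ below) n≤i)) (sym (coef-0∷[] (i ∸ n)))
      where
      below : DegreeBelow n (nth bs (Fin.toℕ j))
      below = All-nth bs dbs (subst (Fin.toℕ j <_) (sym lbs) (Finₚ.toℕ<n j))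

    xCoeff-fromXCoeffs : ∀ bs → Admissible n bs → ∀ j → xCoeff (fromXCoeffs {n} bs) j ≡ nth bs (Fin.toℕ j)
    xCoeff-fromXCoeffs bs adm j =
      NF-∼⇒≡ (norm-NF (column a j ++ (δ₀ j ∷ []))) (NF-nth bs adm j) (mk∼ coefs)
      where
      open ≡-Reasoning
      a = fromXCoeffs {n} bs
      B = nth bs (Fin.toℕ j)
      coefs : ∀ i → coef (xCoeff a j) i ≡ coef B i
      coefs i with i <? n
      ... | yes i<n = begin
        coef (xCoeff a j) i                 ≡⟨ cong (coef (xCoeff a j)) (Finₚ.toℕ-fromℕ< i<n) ⟨
        coef (xCoeff a j) (Fin.toℕ k)       ≡⟨ coef-xCoeff-< a j k ⟩
        Vec.lookup (Vec.lookup a k) j       ≡⟨ cong (λ v → Vec.lookup v j) (Vecₚ.lookup∘tabulate _ k) ⟩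
        Vec.lookup (Vec.tabulate (λ j → coef (nth bs (Fin.toℕ j)) (Fin.toℕ k))) j
                                            ≡⟨ Vecₚ.lookup∘tabulate (λ j → coef (nth bs (Fin.toℕ j)) (Fin.toℕ k)) j ⟩
        coef B (Fin.toℕ k)                  ≡⟨ cong (coef B) (Finₚ.toℕ-fromℕ< i<n) ⟩
        coef B i                            ∎
        where k = Fin.fromℕ< i<n
      ... | no i≮n =
        trans (coef-xCoeff-≥ a j (ℕP.≮⇒≥ i≮n)) (sym (coef-nth-≥ bs adm j (ℕP.≮⇒≥ i≮n)))

    xCoeffs-fromXCoeffs : ∀ bs → Admissible n bs → xCoeffs (fromXCoeffs {n} bs) ≡ bs
    xCoeffs-fromXCoeffs (b ∷ bs) adm = trans (xCoeffs≡tabulate (fromXCoeffs {n} (b ∷ bs)))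
      (trans (cong Vec.toList (Vecₚ.tabulate-cong (xCoeff-fromXCoeffs (b ∷ bs) adm)))
             (tabulate-nth (b ∷ bs) (cong suc (proj₂ (proj₂ adm)))))

  Coefficients↔Tuples : ∀ {n} → Coefficients n ↔ Tuples n
  Coefficients↔Tuples = mk↔ₛ′ (λ a → xCoeffs a , xCoeffs-Admissible a) (fromXCoeffs ∘ proj₁)
    (λ (bs , adm) → Tuples-≡ (xCoeffs-fromXCoeffs bs adm)) fromXCoeffs-xCoeffs

  foldr-deg-DegreeBelow : ∀ {m} bs → All (DegreeBelow m) bs → foldr (λ c x → deg c ⊔ x) 0 bs ≤ m
  foldr-deg-DegreeBelow []       []                = z≤n
  foldr-deg-DegreeBelow (b ∷ bs) ((nb , lb) ∷ dbs) = ℕP.⊔-lub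
    (ℕP.≤-trans (ℕP.m∸n≤m _ 1) (subst (_≤ _) (sym (cong length nb)) lb)) (foldr-deg-DegreeBelow bs dbs)

  foldr-deg-Admissible : ∀ {m} bs → Admissible m bs → foldr (λ c x → deg c ⊔ x) 0 bs ≡ m
  foldr-deg-Admissible (b ∷ bs) ((nb , lb , _) , dbs , _) =
    trans (cong (_⊔ foldr (λ c x → deg c ⊔ x) 0 bs) (cong (_∸ 1) (trans (cong length nb) lb)))
          (ℕP.m≥n⇒m⊔n≡m (foldr-deg-DegreeBelow bs dbs))

  degYg≡ : ∀ {n c} (a : Coefficients n) (mC : IsMonic c) → conX a ≡ c → degYg a ≡ n ∸ degree mC
  degYg≡ a mC refl = foldr-deg-Admissible _
    (proj₂ (quotAll-Admissible (xCoeffs a) mC (xCoeffs-Admissible a)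
      (IsGcdList.divides-all (gcdList-spec (xCoeffs a)))))

  Favourable↔WithContent : ∀ {n c} (mC : IsMonic c) →
    Σ (Coefficients n) (λ a → (conX a ≡ c) × (degYg a ≡ n ∸ degree mC)) ↔ WithContent n c
  Favourable↔WithContent {n} {c} mC = mk↔ₛ′
    (λ (a , conX≡c , _) → (xCoeffs a , xCoeffs-Admissible a) , conX≡c)
    (λ ((bs , adm) , e) →
      fromXCoeffs bs , content≡ bs adm e , degYg≡ (fromXCoeffs bs) mC (content≡ bs adm e))
    (λ ((bs , adm) , _) → WithContent-≡ (xCoeffs-fromXCoeffs bs adm))
    (λ (a , _) → Σ-≡-irrelevant (fromXCoeffs-xCoeffs a))
    where
    content≡ : ∀ bs → Admissible n bs → gcdList bs ≡ c → conX (fromXCoeffs {n} bs) ≡ c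
    content≡ bs adm e = trans (cong gcdList (xCoeffs-fromXCoeffs bs adm)) e
    Σ-≡-irrelevant : ∀ {a a' : Coefficients n} {x y} → a ≡ a' → (a , x) ≡ (a' , y)
    Σ-≡-irrelevant {a} {x = x} {y} refl = cong (a ,_) (×-irrelevant ≡-irrelevantₚ ℕP.≡-irrelevant x y)

  -- Counting

  Tuples↔Fin : ∀ m → Tuples m ↔ Fin ((q ^ suc d) ^ m)
  Tuples↔Fin m = ↔-trans (↔-sym Coefficients↔Tuples) (Vec↔Fin^ (Vec↔Fin^ enum (suc d)) m)

  Primitive-count : ∀ m {N} → Primitive (suc m) ↔ Fin N → (q ^ suc d) ^ suc m ≡ N + q * (q ^ suc d) ^ m
  Primitive-count m {N} prim↔ = Fin↔Fin⇒≡
    (↔-trans (↔-sym (Tuples↔Fin (suc m)))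
    (↔-trans Tuples-suc↔
    (↔-trans (prim↔ ⊎-↔ (enum ×-↔ Tuples↔Fin m))
    (↔-trans (↔-refl ⊎-↔ ↔-sym Finₚ.*↔×)
             (↔-sym Finₚ.+↔⊎)))))

  WithContent-count : ∀ {n c N} (mC : IsMonic c) → degree mC < n → WithContent n c ↔ Fin N →
                      N * q ^ d * q ^ (degree mC * suc d) ≡ (q ^ d ∸ 1) * q ^ (n * suc d)
  WithContent-count {n} {c} {N} mC k<n withContent↔ =
    subst (λ n → N * q ^ d * q ^ (k * suc d) ≡ (q ^ d ∸ 1) * q ^ (n * suc d)) 1+m+k≡n
      (count-closed-form q d m k N (Primitive-count m primitive↔))
    where
    k = degree mC
    m = n ∸ suc k
    1+m+k≡n : suc m + k ≡ n
    1+m+k≡n = trans (sym (ℕP.+-suc m k)) (ℕP.m∸n+n≡m k<n)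
    n∸k≡1+m : n ∸ k ≡ suc m
    n∸k≡1+m = ℕP.+-∸-assoc 1 k<n
    primitive↔ : Primitive (suc m) ↔ Fin N
    primitive↔ = subst (λ j → Primitive j ↔ Fin N) n∸k≡1+m
      (↔-trans (↔-sym (WithContent↔Primitive mC (ℕP.<⇒≤ k<n))) withContent↔)


proposition1p8 : (𝔽 : FiniteField) (d n k : ℕ) → d ≥ 1 → n ≥ 1 → k < n →
    (c₀ : Poly.P 𝔽) → Poly.Monic 𝔽 c₀ → length c₀ ≡ suc k →
    (N : ℕ) →
    (Σ (Vec (Vec (FiniteField.F 𝔽) (suc d)) n)
       (λ a → (Poly.conX 𝔽 a ≡ c₀) × (Poly.degYg 𝔽 a ≡ n ∸ k)) ↔ Fin N) →
    N * FiniteField.q 𝔽 ^ d * FiniteField.q 𝔽 ^ (k * suc d)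
      ≡ (FiniteField.q 𝔽 ^ d ∸ 1) * FiniteField.q 𝔽 ^ (n * suc d)
proposition1p8 𝔽 d n _ _ _ k<n (a ∷ cs) monic refl N favourable↔ =
  WithContent-count mC k<n (↔-trans (↔-sym (Favourable↔WithContent mC)) favourable↔)
  where
  open PolynomialArithmetic 𝔽 using (Monic⇒IsMonic)
  open ContentDecomposition 𝔽 d
  mC = Monic⇒IsMonic monic
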